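{- Let $p$ be an odd prime, let $n\in\mathbb{Z}_p$ be a nonsquare modulo $p$, and let $\alpha,\beta\in\mathbb{Z}_p$ satisfy $\beta-n\alpha+(n^2+n)=0$. Let $v_0=(1,1,\dots,1)$, $v_1=(0,1,\dots,p-1)$, $v_2=(0^2,1^2,\dots,(p-1)^2)$ in $\mathbb{Z}_p^p$, and for $v,w\in\mathbb{Z}_p^p$ let $(v,w)\in\mathbb{Z}_p^{2p}$ denote their concatenation. Let $\mathbb{L}'$ be the $2p\times 2p$ matrix over $\mathbb{Z}_p$ whose rows, indexed from $0$, are, for $0\le k\le p-1$, $$L'_k = 2k(v_1,nv_1)+k^2\big((\alpha-1)v_0,(\alpha-n)v_0\big),$$ $$L'_{k+p} = (v_2,nv_2)-2nk(v_1,v_1)+k^2\big((\beta+n^2)v_0,(\beta+n)v_0\big).$$ Then $\mathbb{L}'$ is log-Hadamard and has rank four over $\mathbb{Z}_p$.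
   Context: A vector with entries in $\mathbb{Z}_p$ is equidistributed if each of the values $0,1,\dots,p-1$ appears the same number of times among its entries. A square matrix with entries in $\mathbb{Z}_p$ is log-Hadamard if the difference of any two distinct rows is an equidistributed vector. -}

module Defs where

open import Data.Nat as ℕ using (ℕ; zero; suc; NonZero)
open import Data.Nat.DivMod using (_mod_)
open import Data.Fin as Fin using (Fin; toℕ; splitAt)
open import Data.Fin.Properties using (_≟_)
open import Data.Fin using () renaming (zero to fzero; suc to fsuc)
open import Data.List using (List; filter; length; allFin)
open import Data.Sum using (inj₁; inj₂)
open import Data.Product using (Σ)
open import Relation.Binary.PropositionalEquality using (_≡_; _≢_)
open import Relation.Nullary using (¬_)

module Zmod (p : ℕ) .{{_ : NonZero p}} where

  Zp : Set
  Zp = Fin p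

  ι : ℕ → Zp
  ι k = k mod p

  infixl 6 _⊕_ _⊖_
  infixl 7 _⊗_

  _⊕_ : Zp → Zp → Zp
  a ⊕ b = ι (toℕ a ℕ.+ toℕ b)

  _⊗_ : Zp → Zp → Zp
  a ⊗ b = ι (toℕ a ℕ.* toℕ b)

  ⊝_ : Zp → Zp
  ⊝ a = ι (p ℕ.∸ toℕ a)

  _⊖_ : Zp → Zp → Zp
  a ⊖ b = a ⊕ (⊝ b)

  𝟘 𝟙 𝟚 : Zp
  𝟘 = ι 0
  𝟙 = ι 1
  𝟚 = ι 2

  NonSquare : Zp → Set
  NonSquare a = ¬ Σ Zp (λ x → x ⊗ x ≡ a)

  ZVec : ℕ → Set
  ZVec m = Fin m → Zp

  _+ᵥ_ : ∀ {m} → ZVec m → ZVec m → ZVec m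
  (v +ᵥ w) j = v j ⊕ w j

  _-ᵥ_ : ∀ {m} → ZVec m → ZVec m → ZVec m
  (v -ᵥ w) j = v j ⊖ w j

  _·ᵥ_ : ∀ {m} → Zp → ZVec m → ZVec m
  (c ·ᵥ v) j = c ⊗ v j

  concat : ∀ {m m'} → ZVec m → ZVec m' → ZVec (m ℕ.+ m')
  concat {m} v w j with splitAt m j
  ... | inj₁ i = v i
  ... | inj₂ i = w i

  count : ∀ {m} → ZVec m → Zp → ℕ
  count {m} v a = length (filter (λ j → v j ≟ a) (allFin m))

  Equidistributed : ∀ {m} → ZVec m → Set
  Equidistributed v = ∀ a b → count v a ≡ count v b

  Matrix : ℕ → ℕ → Set
  Matrix r c = Fin r → ZVec c

  LogHadamard : ∀ {m} → Matrix m m → Set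
  LogHadamard M = ∀ i j → i ≢ j → Equidistributed (M i -ᵥ M j)

  linComb : ∀ {r m} → (Fin r → Zp) → (Fin r → ZVec m) → ZVec m
  linComb {zero}  c u j = 𝟘
  linComb {suc r} c u j = (c fzero ⊗ u fzero j) ⊕ linComb (λ i → c (fsuc i)) (λ i → u (fsuc i)) j

  LinearlyIndependent : ∀ {r m} → (Fin r → ZVec m) → Set
  LinearlyIndependent {r} u =
    ∀ (c : Fin r → Zp) → (∀ j → linComb c u j ≡ 𝟘) → ∀ i → c i ≡ 𝟘

  HasRank : ∀ {m k} → Matrix m k → ℕ → Set
  HasRank {m} M r =
    Σ (Fin r → Fin m) (λ σ → LinearlyIndependent (λ i → M (σ i)))
    Data.Product.× (∀ (τ : Fin (suc r) → Fin m) → ¬ LinearlyIndependent (λ i → M (τ i)))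

  v₀ v₁ v₂ : ZVec p
  v₀ j = 𝟙
  v₁ j = ι (toℕ j)
  v₂ j = ι (toℕ j ℕ.* toℕ j)

  L′ : (n α β : Zp) → Matrix (p ℕ.+ p) (p ℕ.+ p)
  L′ n α β i with splitAt p i
  ... | inj₁ k = ((𝟚 ⊗ k) ·ᵥ concat v₁ (n ·ᵥ v₁))
                  +ᵥ ((k ⊗ k) ·ᵥ concat ((α ⊖ 𝟙) ·ᵥ v₀) ((α ⊖ n) ·ᵥ v₀))
  ... | inj₂ k = (concat v₂ (n ·ᵥ v₂) -ᵥ ((𝟚 ⊗ n ⊗ k) ·ᵥ concat v₁ v₁))
                  +ᵥ ((k ⊗ k) ·ᵥ concat ((β ⊕ n ⊗ n) ·ᵥ v₀) ((β ⊕ n) ·ᵥ v₀))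

-- The difference of two rows of 𝕃′ is, on each half of the columns, a
-- polynomial in the column index x. For two rows of the same block it is affine with
-- nonzero slope 2(k − l), 2n(k − l) or 2n(l − k), so each half takes every value once.
-- For rows of different blocks, completing the square turns the halves into K − (x − h)²
-- and K − n(x − h′)² with a common constant K; the equations (x − h)² = K − t and
-- n(x − h′)² = K − t then have 1 + 1, 2 + 0 or 0 + 2 solutions according as K − t is
-- zero, a nonzero square or a nonsquare, because n is a nonsquare and a product of two
-- nonsquares is a square. So every value occurs exactly twice in every row difference.
-- The relation between α and β makes every row a combination of the four vectors
-- (v₁, nv₁), ((α − 1)v₀, (α − n)v₀), (v₂, nv₂) and (v₁, v₁), hence any five rows are
-- dependent; these four vectors are independent because n ≠ 1, and so are the coordinate
-- vectors of the rows L′₁, L′₋₁, L′ₚ and L′ₚ₊₁.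
module Submission where

open import Defs
open import Algebra.Bundles using (CommutativeRing; RawRing)
open import Algebra.Structures using (IsCommutativeRing)
import Algebra.Properties.AbelianGroup as AbelianGroupProperties
import Algebra.Properties.CommutativeSemigroup as CommutativeSemigroupProperties
import Algebra.Properties.Group as GroupProperties
import Algebra.Properties.Ring as RingProperties
import Algebra.Properties.Semiring.Sum as SemiringSum
import Algebra.Solver.Ring as RingSolver
open import Algebra.Solver.Ring.AlmostCommutativeRing using (fromCommutativeRing; _-Raw-AlmostCommutative⟶_)
open import Data.Bool using (true; false; if_then_else_)
open import Data.Empty using (⊥-elim)
open import Data.Fin using (Fin; toℕ; splitAt; join; punchIn; punchOut; _↑ˡ_; _↑ʳ_)
  renaming (zero to fzero; suc to fsuc)
open import Data.Fin.Properties
  using (_≟_; any?; toℕ-fromℕ<; toℕ-injective; toℕ<n; suc-injective; pigeonhole; punchOut-injective; <⇒≢;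
         join-splitAt; splitAt-join; splitAt-↑ˡ; splitAt-↑ʳ)
open import Data.List using (filter; length; tabulate)
open import Data.Maybe using (Maybe; just; nothing)
open import Data.Nat as ℕ using (ℕ; zero; suc; NonZero; _%_)
import Data.Nat.Properties as ℕ
open import Data.Nat.DivMod
  using (_/_; m%n<n; m≡m%n+[m/n]*n; %-distribˡ-+; %-distribˡ-*; m%n%n≡m%n; n%n≡0; m<n⇒m%n≡m)
open import Data.Nat.Divisibility using (_∣_; ∣-refl; ∣⇒≤; m%n≡0⇒n∣m; n∣m⇒m%n≡0)
open import Data.Nat.Primality using (Prime; prime⇒nonTrivial; euclidsLemma)
open import Data.Product using (Σ; _×_; _,_; proj₁; proj₂)
open import Data.Sum as Sum using (_⊎_; inj₁; inj₂; [_,_]′)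
open import Data.Vec.Functional using ([]; _∷_; insertAt)
open import Data.Vec.Functional.Properties using (insertAt-lookup; insertAt-punchIn)
open import Function using (_∘_; id)
open import Function.Definitions using (Injective)
open import Relation.Binary.PropositionalEquality
open import Relation.Nullary using (¬_; yes; no; does)
open import Relation.Nullary.Decidable using (¬?; decidable-stable; _⊎-dec_)
open import Relation.Unary using (Pred; Decidable)

module ResidueRing (p : ℕ) .{{_ : NonZero p}} where
  open Zmod p
  open ≡-Reasoning

  toℕ-ι : ∀ m → toℕ (ι m) ≡ m % p
  toℕ-ι m = toℕ-fromℕ< _

  ι-toℕ : ∀ a → ι (toℕ a) ≡ a
  ι-toℕ a = toℕ-injective (trans (toℕ-ι (toℕ a)) (m<n⇒m%n≡m (toℕ<n a)))

  ι-% : ∀ m → ι (m % p) ≡ ι m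
  ι-% m = toℕ-injective (begin
    toℕ (ι (m % p)) ≡⟨ toℕ-ι (m % p) ⟩
    m % p % p       ≡⟨ m%n%n≡m%n m p ⟩
    m % p           ≡⟨ toℕ-ι m ⟨
    toℕ (ι m)       ∎)

  ι-+ : ∀ m n → ι m ⊕ ι n ≡ ι (m ℕ.+ n)
  ι-+ m n = toℕ-injective (begin
    toℕ (ι (toℕ (ι m) ℕ.+ toℕ (ι n))) ≡⟨ toℕ-ι _ ⟩
    (toℕ (ι m) ℕ.+ toℕ (ι n)) % p     ≡⟨ cong₂ (λ a b → (a ℕ.+ b) % p) (toℕ-ι m) (toℕ-ι n) ⟩
    (m % p ℕ.+ n % p) % p             ≡⟨ %-distribˡ-+ m n p ⟨
    (m ℕ.+ n) % p                     ≡⟨ toℕ-ι _ ⟨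
    toℕ (ι (m ℕ.+ n))                 ∎)

  ι-* : ∀ m n → ι m ⊗ ι n ≡ ι (m ℕ.* n)
  ι-* m n = toℕ-injective (begin
    toℕ (ι (toℕ (ι m) ℕ.* toℕ (ι n))) ≡⟨ toℕ-ι _ ⟩
    (toℕ (ι m) ℕ.* toℕ (ι n)) % p     ≡⟨ cong₂ (λ a b → (a ℕ.* b) % p) (toℕ-ι m) (toℕ-ι n) ⟩
    (m % p ℕ.* (n % p)) % p           ≡⟨ %-distribˡ-* m n p ⟨
    (m ℕ.* n) % p                     ≡⟨ toℕ-ι _ ⟨
    toℕ (ι (m ℕ.* n))                 ∎)

  toℕ-𝟘 : toℕ 𝟘 ≡ 0
  toℕ-𝟘 = trans (toℕ-ι 0) (m<n⇒m%n≡m (ℕ.>-nonZero⁻¹ p))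

  ι≡𝟘⇒∣ : ∀ m → ι m ≡ 𝟘 → p ∣ m
  ι≡𝟘⇒∣ m eq = m%n≡0⇒n∣m m p (trans (sym (toℕ-ι m)) (trans (cong toℕ eq) toℕ-𝟘))

  ∣⇒ι≡𝟘 : ∀ m → p ∣ m → ι m ≡ 𝟘
  ∣⇒ι≡𝟘 m p∣m = trans (sym (ι-% m)) (cong ι (n∣m⇒m%n≡0 m p p∣m))

  ι-injective : ∀ {m n} → m ℕ.< p → n ℕ.< p → ι m ≡ ι n → m ≡ n
  ι-injective {m} {n} m<p n<p eq = begin
    m             ≡⟨ m<n⇒m%n≡m m<p ⟨
    m % p         ≡⟨ toℕ-ι m ⟨
    toℕ (ι m)     ≡⟨ cong toℕ eq ⟩
    toℕ (ι n)     ≡⟨ toℕ-ι n ⟩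
    n % p         ≡⟨ m<n⇒m%n≡m n<p ⟩
    n             ∎

  ι-suc-≢𝟘 : ∀ m → suc m ℕ.< p → ι (suc m) ≢ 𝟘
  ι-suc-≢𝟘 m m<p eq = ℕ.<⇒≱ m<p (∣⇒≤ (ι≡𝟘⇒∣ (suc m) eq))

  ⊕-assoc : ∀ a b c → (a ⊕ b) ⊕ c ≡ a ⊕ (b ⊕ c)
  ⊕-assoc a b c = begin
    ι (A ℕ.+ B) ⊕ c       ≡⟨ cong (ι (A ℕ.+ B) ⊕_) (ι-toℕ c) ⟨
    ι (A ℕ.+ B) ⊕ ι C     ≡⟨ ι-+ (A ℕ.+ B) C ⟩
    ι (A ℕ.+ B ℕ.+ C)     ≡⟨ cong ι (ℕ.+-assoc A B C) ⟩
    ι (A ℕ.+ (B ℕ.+ C))   ≡⟨ ι-+ A (B ℕ.+ C) ⟨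
    ι A ⊕ ι (B ℕ.+ C)     ≡⟨ cong (_⊕ ι (B ℕ.+ C)) (ι-toℕ a) ⟩
    a ⊕ (b ⊕ c)           ∎
    where A = toℕ a; B = toℕ b; C = toℕ c

  ⊗-assoc : ∀ a b c → (a ⊗ b) ⊗ c ≡ a ⊗ (b ⊗ c)
  ⊗-assoc a b c = begin
    ι (A ℕ.* B) ⊗ c       ≡⟨ cong (ι (A ℕ.* B) ⊗_) (ι-toℕ c) ⟨
    ι (A ℕ.* B) ⊗ ι C     ≡⟨ ι-* (A ℕ.* B) C ⟩
    ι (A ℕ.* B ℕ.* C)     ≡⟨ cong ι (ℕ.*-assoc A B C) ⟩
    ι (A ℕ.* (B ℕ.* C))   ≡⟨ ι-* A (B ℕ.* C) ⟨
    ι A ⊗ ι (B ℕ.* C)     ≡⟨ cong (_⊗ ι (B ℕ.* C)) (ι-toℕ a) ⟩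
    a ⊗ (b ⊗ c)           ∎
    where A = toℕ a; B = toℕ b; C = toℕ c

  ⊗-distribʳ-⊕ : ∀ a b c → (b ⊕ c) ⊗ a ≡ (b ⊗ a) ⊕ (c ⊗ a)
  ⊗-distribʳ-⊕ a b c = begin
    ι (B ℕ.+ C) ⊗ a                 ≡⟨ cong (ι (B ℕ.+ C) ⊗_) (ι-toℕ a) ⟨
    ι (B ℕ.+ C) ⊗ ι A               ≡⟨ ι-* (B ℕ.+ C) A ⟩
    ι ((B ℕ.+ C) ℕ.* A)             ≡⟨ cong ι (ℕ.*-distribʳ-+ A B C) ⟩
    ι (B ℕ.* A ℕ.+ C ℕ.* A)         ≡⟨ ι-+ (B ℕ.* A) (C ℕ.* A) ⟨
    ι (B ℕ.* A) ⊕ ι (C ℕ.* A)       ≡⟨ cong₂ _⊕_ (ι-* B A) (ι-* C A) ⟨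
    (ι B ⊗ ι A) ⊕ (ι C ⊗ ι A)       ≡⟨ cong₂ (λ x y → (x ⊗ ι A) ⊕ (y ⊗ ι A)) (ι-toℕ b) (ι-toℕ c) ⟩
    (b ⊗ ι A) ⊕ (c ⊗ ι A)           ≡⟨ cong (λ x → (b ⊗ x) ⊕ (c ⊗ x)) (ι-toℕ a) ⟩
    (b ⊗ a) ⊕ (c ⊗ a)               ∎
    where A = toℕ a; B = toℕ b; C = toℕ c

  ⊕-comm : ∀ a b → a ⊕ b ≡ b ⊕ a
  ⊕-comm a b = cong ι (ℕ.+-comm (toℕ a) (toℕ b))

  ⊗-comm : ∀ a b → a ⊗ b ≡ b ⊗ a
  ⊗-comm a b = cong ι (ℕ.*-comm (toℕ a) (toℕ b))

  ⊕-identityˡ : ∀ a → 𝟘 ⊕ a ≡ a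
  ⊕-identityˡ a = trans (cong (𝟘 ⊕_) (sym (ι-toℕ a))) (trans (ι-+ 0 (toℕ a)) (ι-toℕ a))

  ⊗-identityˡ : ∀ a → 𝟙 ⊗ a ≡ a
  ⊗-identityˡ a = trans (cong (𝟙 ⊗_) (sym (ι-toℕ a)))
    (trans (ι-* 1 (toℕ a)) (trans (cong ι (ℕ.*-identityˡ (toℕ a))) (ι-toℕ a)))

  ⊝-inverseˡ : ∀ a → (⊝ a) ⊕ a ≡ 𝟘
  ⊝-inverseˡ a = begin
    ι (p ℕ.∸ toℕ a) ⊕ a              ≡⟨ cong (ι (p ℕ.∸ toℕ a) ⊕_) (ι-toℕ a) ⟨
    ι (p ℕ.∸ toℕ a) ⊕ ι (toℕ a)      ≡⟨ ι-+ (p ℕ.∸ toℕ a) (toℕ a) ⟩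
    ι (p ℕ.∸ toℕ a ℕ.+ toℕ a)        ≡⟨ cong ι (ℕ.m∸n+n≡m (ℕ.<⇒≤ (toℕ<n a))) ⟩
    ι p                              ≡⟨ ι-% p ⟨
    ι (p % p)                        ≡⟨ cong ι (n%n≡0 p) ⟩
    𝟘                                ∎

  isCommutativeRing : IsCommutativeRing _≡_ _⊕_ _⊗_ ⊝_ 𝟘 𝟙
  isCommutativeRing = record
    { isRing = record
      { +-isAbelianGroup = record
        { isGroup = record
          { isMonoid = record
            { isSemigroup = record
              { isMagma = record { isEquivalence = isEquivalence ; ∙-cong = cong₂ _⊕_ }
              ; assoc = ⊕-assoc }
            ; identity = ⊕-identityˡ , λ a → trans (⊕-comm a 𝟘) (⊕-identityˡ a) }
          ; inverse = ⊝-inverseˡ , λ a → trans (⊕-comm a (⊝ a)) (⊝-inverseˡ a)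
          ; ⁻¹-cong = cong ⊝_ }
        ; comm = ⊕-comm }
      ; *-cong = cong₂ _⊗_
      ; *-assoc = ⊗-assoc
      ; *-identity = ⊗-identityˡ , λ a → trans (⊗-comm a 𝟙) (⊗-identityˡ a)
      ; distrib = (λ a b c → trans (⊗-comm a (b ⊕ c))
                     (trans (⊗-distribʳ-⊕ a b c) (cong₂ _⊕_ (⊗-comm b a) (⊗-comm c a))))
                , ⊗-distribʳ-⊕ }
    ; *-comm = ⊗-comm }

  commutativeRing : CommutativeRing _ _
  commutativeRing = record { isCommutativeRing = isCommutativeRing }

  IsSquare : Zp → Set
  IsSquare a = Σ Zp (λ x → x ⊗ x ≡ a)

  open CommutativeRing commutativeRing public
    using (+-group; +-abelianGroup; ring; zeroˡ; zeroʳ)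
    renaming (+-identityʳ to ⊕-identityʳ; *-identityʳ to ⊗-identityʳ; -‿inverseʳ to ⊝-inverseʳ)

  nonsquare⇒≢𝟘 : ∀ {a} → ¬ IsSquare a → a ≢ 𝟘
  nonsquare⇒≢𝟘 a-nonsquare a≡𝟘 = a-nonsquare (𝟘 , trans (zeroˡ 𝟘) (sym a≡𝟘))

-- The ring solver for ℤ/p takes formal differences of naturals as coefficients: unlike
-- residues, they compute although p is a variable.
module ResidueSolver (p : ℕ) .{{_ : NonZero p}} where
  open Zmod p
  open ResidueRing p
  open CommutativeRing commutativeRing using (+-commutativeSemigroup)
  open AbelianGroupProperties +-abelianGroup using (⁻¹-∙-comm; ⁻¹-anti-homo‿-)
  open GroupProperties +-group using (ε⁻¹≈ε)
  open RingProperties ring using (x[y-z]≈xy-xz; [y-z]x≈yx-zx)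
  open CommutativeSemigroupProperties +-commutativeSemigroup using (interchange)
  open ≡-Reasoning

  -- Coefficients are kept normalised: the solver compares normal forms syntactically.
  normaliseᵈ : ℕ → ℕ → ℕ × ℕ
  normaliseᵈ a b = a ℕ.∸ b , b ℕ.∸ a

  Diff : RawRing _ _
  Diff = record
    { Carrier = ℕ × ℕ ; _≈_ = _≡_
    ; _+_ = λ (a , b) (c , d) → normaliseᵈ (a ℕ.+ c) (b ℕ.+ d)
    ; _*_ = λ (a , b) (c , d) → normaliseᵈ (a ℕ.* c ℕ.+ b ℕ.* d) (a ℕ.* d ℕ.+ b ℕ.* c)
    ; -_ = λ (a , b) → b , a
    ; 0# = 0 , 0 ; 1# = 1 , 0 }

  -- Differences (a , 0) are interpreted as ι a on the nose, so that the constants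
  -- (0 , 0), (1 , 0) and (2 , 0) denote 𝟘, 𝟙 and 𝟚 definitionally.
  ⟦_⟧ᵈ : ℕ × ℕ → Zp
  ⟦ a , zero ⟧ᵈ = ι a
  ⟦ a , suc b ⟧ᵈ = ι a ⊖ ι (suc b)

  ⟦⟧ᵈ-≡ : ∀ a b → ⟦ a , b ⟧ᵈ ≡ ι a ⊖ ι b
  ⟦⟧ᵈ-≡ a zero = sym (trans (cong (ι a ⊕_) ε⁻¹≈ε) (⊕-identityʳ (ι a)))
  ⟦⟧ᵈ-≡ a (suc b) = refl

  ⊖-interchange : ∀ x y z w → (x ⊕ y) ⊖ (z ⊕ w) ≡ (x ⊖ z) ⊕ (y ⊖ w)
  ⊖-interchange x y z w =
    trans (cong ((x ⊕ y) ⊕_) (sym (⁻¹-∙-comm z w))) (interchange x y (⊝ z) (⊝ w))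

  ι-⊖-cancel : ∀ a b k → ι (a ℕ.+ k) ⊖ ι (b ℕ.+ k) ≡ ι a ⊖ ι b
  ι-⊖-cancel a b k = begin
    ι (a ℕ.+ k) ⊖ ι (b ℕ.+ k)        ≡⟨ cong₂ _⊖_ (ι-+ a k) (ι-+ b k) ⟨
    (ι a ⊕ ι k) ⊖ (ι b ⊕ ι k)        ≡⟨ ⊖-interchange (ι a) (ι k) (ι b) (ι k) ⟩
    (ι a ⊖ ι b) ⊕ (ι k ⊖ ι k)        ≡⟨ cong ((ι a ⊖ ι b) ⊕_) (⊝-inverseʳ (ι k)) ⟩
    (ι a ⊖ ι b) ⊕ 𝟘                  ≡⟨ ⊕-identityʳ (ι a ⊖ ι b) ⟩
    ι a ⊖ ι b                        ∎

  ι-⊖-cong : ∀ a b c d → a ℕ.+ d ≡ c ℕ.+ b → ι a ⊖ ι b ≡ ι c ⊖ ι d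
  ι-⊖-cong a b c d eq = begin
    ι a ⊖ ι b                        ≡⟨ ι-⊖-cancel a b d ⟨
    ι (a ℕ.+ d) ⊖ ι (b ℕ.+ d)        ≡⟨ cong₂ (λ u v → ι u ⊖ ι v) eq (ℕ.+-comm b d) ⟩
    ι (c ℕ.+ b) ⊖ ι (d ℕ.+ b)        ≡⟨ ι-⊖-cancel c d b ⟩
    ι c ⊖ ι d                        ∎

  ∸+≡+∸ : ∀ a b → (a ℕ.∸ b) ℕ.+ b ≡ a ℕ.+ (b ℕ.∸ a)
  ∸+≡+∸ zero zero = refl
  ∸+≡+∸ zero (suc b) = refl
  ∸+≡+∸ (suc a) zero = refl
  ∸+≡+∸ (suc a) (suc b) = trans (ℕ.+-suc (a ℕ.∸ b) b) (cong suc (∸+≡+∸ a b))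

  ⟦normalise⟧ᵈ : ∀ a b → ⟦ normaliseᵈ a b ⟧ᵈ ≡ ι a ⊖ ι b
  ⟦normalise⟧ᵈ a b = trans (⟦⟧ᵈ-≡ (a ℕ.∸ b) (b ℕ.∸ a)) (ι-⊖-cong (a ℕ.∸ b) (b ℕ.∸ a) a b (∸+≡+∸ a b))

  ⟦⟧ᵈ-+ : ∀ a b c d → ⟦ normaliseᵈ (a ℕ.+ c) (b ℕ.+ d) ⟧ᵈ ≡ ⟦ a , b ⟧ᵈ ⊕ ⟦ c , d ⟧ᵈ
  ⟦⟧ᵈ-+ a b c d = begin
    ⟦ normaliseᵈ (a ℕ.+ c) (b ℕ.+ d) ⟧ᵈ ≡⟨ ⟦normalise⟧ᵈ (a ℕ.+ c) (b ℕ.+ d) ⟩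
    ι (a ℕ.+ c) ⊖ ι (b ℕ.+ d)        ≡⟨ cong₂ _⊖_ (ι-+ a c) (ι-+ b d) ⟨
    (ι a ⊕ ι c) ⊖ (ι b ⊕ ι d)        ≡⟨ ⊖-interchange (ι a) (ι c) (ι b) (ι d) ⟩
    (ι a ⊖ ι b) ⊕ (ι c ⊖ ι d)        ≡⟨ cong₂ _⊕_ (⟦⟧ᵈ-≡ a b) (⟦⟧ᵈ-≡ c d) ⟨
    ⟦ a , b ⟧ᵈ ⊕ ⟦ c , d ⟧ᵈ          ∎

  ⟦⟧ᵈ-* : ∀ a b c d → ⟦ normaliseᵈ (a ℕ.* c ℕ.+ b ℕ.* d) (a ℕ.* d ℕ.+ b ℕ.* c) ⟧ᵈ ≡ ⟦ a , b ⟧ᵈ ⊗ ⟦ c , d ⟧ᵈ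
  ⟦⟧ᵈ-* a b c d = begin
    ⟦ normaliseᵈ (a ℕ.* c ℕ.+ b ℕ.* d) (a ℕ.* d ℕ.+ b ℕ.* c) ⟧ᵈ
      ≡⟨ ⟦normalise⟧ᵈ (a ℕ.* c ℕ.+ b ℕ.* d) (a ℕ.* d ℕ.+ b ℕ.* c) ⟩
    ι (a ℕ.* c ℕ.+ b ℕ.* d) ⊖ ι (a ℕ.* d ℕ.+ b ℕ.* c)
      ≡⟨ cong₂ _⊖_ (trans (cong₂ _⊕_ (ι-* a c) (ι-* b d)) (ι-+ _ _))
                   (trans (cong₂ _⊕_ (ι-* a d) (ι-* b c)) (ι-+ _ _)) ⟨
    (x ⊗ z ⊕ y ⊗ w) ⊖ (x ⊗ w ⊕ y ⊗ z)
      ≡⟨ ⊖-interchange (x ⊗ z) (y ⊗ w) (x ⊗ w) (y ⊗ z) ⟩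
    (x ⊗ z ⊖ x ⊗ w) ⊕ (y ⊗ w ⊖ y ⊗ z)
      ≡⟨ cong ((x ⊗ z ⊖ x ⊗ w) ⊕_) (⁻¹-anti-homo‿- (y ⊗ z) (y ⊗ w)) ⟨
    (x ⊗ z ⊖ x ⊗ w) ⊖ (y ⊗ z ⊖ y ⊗ w)
      ≡⟨ cong₂ _⊖_ (x[y-z]≈xy-xz x z w) (x[y-z]≈xy-xz y z w) ⟨
    x ⊗ (z ⊖ w) ⊖ y ⊗ (z ⊖ w)
      ≡⟨ [y-z]x≈yx-zx (z ⊖ w) x y ⟨
    (x ⊖ y) ⊗ (z ⊖ w)
      ≡⟨ cong₂ _⊗_ (⟦⟧ᵈ-≡ a b) (⟦⟧ᵈ-≡ c d) ⟨
    ⟦ a , b ⟧ᵈ ⊗ ⟦ c , d ⟧ᵈ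
      ∎
    where x = ι a; y = ι b; z = ι c; w = ι d

  ⟦⟧ᵈ-homomorphism : Diff -Raw-AlmostCommutative⟶ fromCommutativeRing commutativeRing
  ⟦⟧ᵈ-homomorphism = record
    { ⟦_⟧ = ⟦_⟧ᵈ
    ; +-homo = λ (a , b) (c , d) → ⟦⟧ᵈ-+ a b c d
    ; *-homo = λ (a , b) (c , d) → ⟦⟧ᵈ-* a b c d
    ; -‿homo = λ (a , b) → trans (⟦⟧ᵈ-≡ b a)
                  (trans (sym (⁻¹-anti-homo‿- (ι a) (ι b))) (cong ⊝_ (sym (⟦⟧ᵈ-≡ a b))))
    ; 0-homo = refl
    ; 1-homo = refl }

  ⟦⟧ᵈ-≟ : ∀ x y → Maybe (⟦ x ⟧ᵈ ≡ ⟦ y ⟧ᵈ)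
  ⟦⟧ᵈ-≟ (a , b) (c , d) with a ℕ.+ d ℕ.≟ c ℕ.+ b
  ... | yes eq = just (trans (⟦⟧ᵈ-≡ a b) (trans (ι-⊖-cong a b c d eq) (sym (⟦⟧ᵈ-≡ c d))))
  ... | no _ = nothing

  open RingSolver Diff (fromCommutativeRing commutativeRing) ⟦⟧ᵈ-homomorphism ⟦⟧ᵈ-≟ public


module Counting where
  countWhere : ∀ {m p} {P : Pred (Fin m) p} → Decidable P → ℕ
  countWhere {zero} P? = 0
  countWhere {suc m} P? = (if does (P? fzero) then 1 else 0) ℕ.+ countWhere (P? ∘ fsuc)

  length-filter-tabulate : ∀ {a p} {A : Set a} {P : Pred A p} (P? : Decidable P) {m} (f : Fin m → A) →
    length (filter P? (tabulate f)) ≡ countWhere (P? ∘ f)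
  length-filter-tabulate P? {zero} f = refl
  length-filter-tabulate P? {suc m} f with does (P? (f fzero))
  ... | true = cong suc (length-filter-tabulate P? (f ∘ fsuc))
  ... | false = length-filter-tabulate P? (f ∘ fsuc)

  countWhere-cong : ∀ {m p q} {P : Pred (Fin m) p} {Q : Pred (Fin m) q} (P? : Decidable P) (Q? : Decidable Q) →
    (∀ x → P x → Q x) → (∀ x → Q x → P x) → countWhere P? ≡ countWhere Q?
  countWhere-cong {zero} P? Q? P⇒Q Q⇒P = refl
  countWhere-cong {suc m} P? Q? P⇒Q Q⇒P =
    cong₂ ℕ._+_ head (countWhere-cong (P? ∘ fsuc) (Q? ∘ fsuc) (P⇒Q ∘ fsuc) (Q⇒P ∘ fsuc))
    where
    head : (if does (P? fzero) then 1 else 0) ≡ (if does (Q? fzero) then 1 else 0)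
    head with P? fzero | Q? fzero
    ... | yes _ | yes _ = refl
    ... | yes P0 | no ¬Q0 = ⊥-elim (¬Q0 (P⇒Q fzero P0))
    ... | no ¬P0 | yes Q0 = ⊥-elim (¬P0 (Q⇒P fzero Q0))
    ... | no _ | no _ = refl

  countWhere-↑ : ∀ m n {p} {P : Pred (Fin (m ℕ.+ n)) p} (P? : Decidable P) →
    countWhere P? ≡ countWhere (P? ∘ (_↑ˡ n)) ℕ.+ countWhere (P? ∘ (m ↑ʳ_))
  countWhere-↑ zero n P? = refl
  countWhere-↑ (suc m) n P? =
    trans (cong ((if does (P? fzero) then 1 else 0) ℕ.+_) (countWhere-↑ m n (P? ∘ fsuc)))
          (sym (ℕ.+-assoc (if does (P? fzero) then 1 else 0) _ _))

  countWhere-none : ∀ {m p} {P : Pred (Fin m) p} (P? : Decidable P) → (∀ x → ¬ P x) → countWhere P? ≡ 0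
  countWhere-none {zero} P? none = refl
  countWhere-none {suc m} P? none with P? fzero
  ... | yes P0 = ⊥-elim (none fzero P0)
  ... | no _ = countWhere-none (P? ∘ fsuc) (none ∘ fsuc)

  countWhere-≡ : ∀ {m} (a : Fin m) → countWhere (_≟ a) ≡ 1
  countWhere-≡ {suc m} fzero = cong suc (countWhere-none {m} (λ x → fsuc x ≟ fzero) (λ _ ()))
  countWhere-≡ {suc m} (fsuc a) =
    trans (countWhere-cong (λ x → fsuc x ≟ fsuc a) (_≟ a) (λ _ → suc-injective) (λ _ → cong fsuc))
          (countWhere-≡ a)

  countWhere-⊎ : ∀ {m p q} {P : Pred (Fin m) p} {Q : Pred (Fin m) q} (P? : Decidable P) (Q? : Decidable Q) →
    (∀ x → P x → ¬ Q x) → countWhere (λ x → P? x ⊎-dec Q? x) ≡ countWhere P? ℕ.+ countWhere Q?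
  countWhere-⊎ {zero} P? Q? disjoint = refl
  countWhere-⊎ {suc m} P? Q? disjoint
    with P? fzero | Q? fzero | countWhere-⊎ (P? ∘ fsuc) (Q? ∘ fsuc) (disjoint ∘ fsuc)
  ... | yes P0 | yes Q0 | _ = ⊥-elim (disjoint fzero P0 Q0)
  ... | yes _ | no _ | ih = cong suc ih
  ... | no _ | yes _ | ih = trans (cong suc ih) (sym (ℕ.+-suc _ _))
  ... | no _ | no _ | ih = ih

  countWhere-unique : ∀ {m p} {P : Pred (Fin m) p} (P? : Decidable P) (a : Fin m) →
    P a → (∀ x → P x → x ≡ a) → countWhere P? ≡ 1
  countWhere-unique P? a Pa unique =
    trans (countWhere-cong P? (_≟ a) unique (λ { x refl → Pa })) (countWhere-≡ a)

  countWhere-two : ∀ {m p} {P : Pred (Fin m) p} (P? : Decidable P) (a b : Fin m) → a ≢ b →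
    P a → P b → (∀ x → P x → x ≡ a ⊎ x ≡ b) → countWhere P? ≡ 2
  countWhere-two P? a b a≢b Pa Pb two = begin
    countWhere P?                                    ≡⟨ countWhere-cong P? (λ x → (x ≟ a) ⊎-dec (x ≟ b)) two
                                                          (λ { x (inj₁ refl) → Pa ; x (inj₂ refl) → Pb }) ⟩
    countWhere (λ x → (x ≟ a) ⊎-dec (x ≟ b))         ≡⟨ countWhere-⊎ (_≟ a) (_≟ b) (λ { x refl → a≢b }) ⟩
    countWhere (_≟ a) ℕ.+ countWhere (_≟ b)          ≡⟨ cong₂ ℕ._+_ (countWhere-≡ a) (countWhere-≡ b) ⟩
    2                                                ∎
    where open ≡-Reasoning

-- If f missed y, then punchOut y ∘ f would inject Fin m into a smaller Fin.
fin-injective⇒surjective : ∀ {m n} → n ℕ.≤ m → (f : Fin m → Fin n) → Injective _≡_ _≡_ f →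
  ∀ y → Σ (Fin m) (λ x → f x ≡ y)
fin-injective⇒surjective {m} {suc n} n≤m f inj y with any? (λ x → f x ≟ y)
... | yes hit = hit
... | no miss
  with i , j , i<j , eq ← pigeonhole (ℕ.<-≤-trans (ℕ.n<1+n n) n≤m)
                                     (λ x → punchOut (λ fx≡y → miss (x , sym fx≡y)))
  = ⊥-elim (<⇒≢ i<j (inj (punchOut-injective {i = y} _ _ eq)))

module PrimeField (p : ℕ) .{{_ : NonZero p}} (p-prime : Prime p) where
  open Zmod p
  open ResidueRing p
  open ResidueSolver p using (solve; _:+_; _:-_; _:*_; _:=_)
  open GroupProperties +-group using (x∙y⁻¹≈ε⇒x≈y; x≈y⇒x∙y⁻¹≈ε; inverseˡ-unique)
  open RingProperties ring using (x[y-z]≈xy-xz)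

  1<p : 1 ℕ.< p
  1<p = ℕ.nonTrivial⇒n>1 p {{prime⇒nonTrivial p-prime}}

  𝟙≢𝟘 : 𝟙 ≢ 𝟘
  𝟙≢𝟘 eq = ℕ.<⇒≱ 1<p (∣⇒≤ (ι≡𝟘⇒∣ 1 eq))

  x⊗y≡𝟘⇒x≡𝟘∨y≡𝟘 : ∀ x y → x ⊗ y ≡ 𝟘 → x ≡ 𝟘 ⊎ y ≡ 𝟘
  x⊗y≡𝟘⇒x≡𝟘∨y≡𝟘 x y eq with euclidsLemma (toℕ x) (toℕ y) p-prime (ι≡𝟘⇒∣ _ eq)
  ... | inj₁ p∣x = inj₁ (trans (sym (ι-toℕ x)) (∣⇒ι≡𝟘 _ p∣x))
  ... | inj₂ p∣y = inj₂ (trans (sym (ι-toℕ y)) (∣⇒ι≡𝟘 _ p∣y))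

  ⊗-≢𝟘 : ∀ {x y} → x ≢ 𝟘 → y ≢ 𝟘 → x ⊗ y ≢ 𝟘
  ⊗-≢𝟘 {x} {y} x≢𝟘 y≢𝟘 eq = [ x≢𝟘 , y≢𝟘 ]′ (x⊗y≡𝟘⇒x≡𝟘∨y≡𝟘 x y eq)

  ⊗-≡𝟘ʳ : ∀ {x y} → x ≢ 𝟘 → x ⊗ y ≡ 𝟘 → y ≡ 𝟘
  ⊗-≡𝟘ʳ {x} {y} x≢𝟘 eq = [ (λ x≡𝟘 → ⊥-elim (x≢𝟘 x≡𝟘)) , id ]′ (x⊗y≡𝟘⇒x≡𝟘∨y≡𝟘 x y eq)

  ⊗-cancelˡ : ∀ {x y z} → x ≢ 𝟘 → x ⊗ y ≡ x ⊗ z → y ≡ z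
  ⊗-cancelˡ {x} {y} {z} x≢𝟘 eq =
    x∙y⁻¹≈ε⇒x≈y y z (⊗-≡𝟘ʳ x≢𝟘 (trans (x[y-z]≈xy-xz x y z) (x≈y⇒x∙y⁻¹≈ε eq)))

  opaque
    inverse : ∀ {x} → x ≢ 𝟘 → Σ Zp (λ y → x ⊗ y ≡ 𝟙)
    inverse {x} x≢𝟘 = fin-injective⇒surjective ℕ.≤-refl (x ⊗_) (⊗-cancelˡ x≢𝟘) 𝟙

  square-quotient : ∀ {x y} → y ≢ 𝟘 → IsSquare (x ⊗ (y ⊗ y)) → IsSquare x
  square-quotient {x} {y} y≢𝟘 (z , z⊗z≡x⊗y⊗y) with y′ , y⊗y′≡𝟙 ← inverse y≢𝟘 = z ⊗ y′ , (begin
    (z ⊗ y′) ⊗ (z ⊗ y′)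
      ≡⟨ solve 2 (λ z y′ → (z :* y′) :* (z :* y′) := (z :* z) :* (y′ :* y′)) refl z y′ ⟩
    (z ⊗ z) ⊗ (y′ ⊗ y′)
      ≡⟨ cong (_⊗ (y′ ⊗ y′)) z⊗z≡x⊗y⊗y ⟩
    (x ⊗ (y ⊗ y)) ⊗ (y′ ⊗ y′)
      ≡⟨ solve 3 (λ x y y′ → (x :* (y :* y)) :* (y′ :* y′) := x :* ((y :* y′) :* (y :* y′))) refl x y y′ ⟩
    x ⊗ ((y ⊗ y′) ⊗ (y ⊗ y′))
      ≡⟨ cong (λ u → x ⊗ (u ⊗ u)) y⊗y′≡𝟙 ⟩
    x ⊗ (𝟙 ⊗ 𝟙)
      ≡⟨ trans (cong (x ⊗_) (⊗-identityˡ 𝟙)) (⊗-identityʳ x) ⟩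
    x
      ∎)
    where open ≡-Reasoning

  x⊗x≡y⊗y⇒x≡±y : ∀ x y → x ⊗ x ≡ y ⊗ y → x ≡ y ⊎ x ≡ ⊝ y
  x⊗x≡y⊗y⇒x≡±y x y eq =
    Sum.map (x∙y⁻¹≈ε⇒x≈y x y) (inverseˡ-unique x y) (x⊗y≡𝟘⇒x≡𝟘∨y≡𝟘 _ _ (begin
      (x ⊖ y) ⊗ (x ⊕ y)   ≡⟨ solve 2 (λ x y → (x :- y) :* (x :+ y) := x :* x :- y :* y) refl x y ⟩
      x ⊗ x ⊖ y ⊗ y       ≡⟨ x≈y⇒x∙y⁻¹≈ε eq ⟩
      𝟘                   ∎))
    where open ≡-Reasoning

module OddPrimeField (p : ℕ) .{{_ : NonZero p}} (p-prime : Prime p) (odd : ¬ 2 ∣ p) where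
  open Zmod p
  open ResidueRing p
  open ResidueSolver p using (solve; _:+_; _:*_; _:=_; con)
  open PrimeField p p-prime
  open ≡-Reasoning

  𝟚≢𝟘 : 𝟚 ≢ 𝟘
  𝟚≢𝟘 eq = odd (subst (2 ∣_) (ℕ.≤-antisym 1<p (∣⇒≤ (ι≡𝟘⇒∣ 2 eq))) ∣-refl)

  x≢⊝x : ∀ {x} → x ≢ 𝟘 → x ≢ ⊝ x
  x≢⊝x {x} x≢𝟘 x≡⊝x = ⊗-≢𝟘 𝟚≢𝟘 x≢𝟘 (begin
    𝟚 ⊗ x     ≡⟨ solve 1 (λ x → con (2 , 0) :* x := x :+ x) refl x ⟩
    x ⊕ x     ≡⟨ cong (x ⊕_) x≡⊝x ⟩
    x ⊖ x     ≡⟨ ⊝-inverseʳ x ⟩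
    𝟘         ∎)

  p≡1+h+h : Σ ℕ (λ h → p ≡ suc (h ℕ.+ h))
  p≡1+h+h with p % 2 | m%n<n p 2 | m≡m%n+[m/n]*n p 2 | m%n≡0⇒n∣m p 2
  ... | 0           | _                 | _   | 2∣p = ⊥-elim (odd (2∣p refl))
  ... | 1           | _                 | p≡ | _ =
    p / 2 , trans p≡ (cong suc (trans (ℕ.*-comm (p / 2) 2) (cong (p / 2 ℕ.+_) (ℕ.+-identityʳ (p / 2)))))
  ... | suc (suc _) | ℕ.s≤s (ℕ.s≤s ()) | _   | _

  -- For a nonsquare a, the p residues 0, 1², …, h², a·1², …, a·h² (p = 2h + 1) are
  -- distinct, hence they are all of ℤ/p; so a nonsquare b is some a·t², and a·b = (a·t)².
  private
    module Enumeration (a : Zp) (a-nonsquare : ¬ IsSquare a) (h : ℕ) (p≡ : p ≡ suc (h ℕ.+ h)) where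
      t : Fin h → Zp
      t u = ι (suc (toℕ u))

      t+t<p : ∀ (u w : Fin h) → suc (toℕ u) ℕ.+ suc (toℕ w) ℕ.< p
      t+t<p u w = subst (suc (toℕ u) ℕ.+ suc (toℕ w) ℕ.<_) (sym p≡) (ℕ.s≤s (ℕ.+-mono-≤ (toℕ<n u) (toℕ<n w)))

      t<p : ∀ (u : Fin h) → suc (toℕ u) ℕ.< p
      t<p u = ℕ.≤-<-trans (ℕ.m≤m+n (suc (toℕ u)) (suc (toℕ u))) (t+t<p u u)

      t≢𝟘 : ∀ u → t u ≢ 𝟘
      t≢𝟘 u = ι-suc-≢𝟘 (toℕ u) (t<p u)

      t-injective : ∀ {u w} → t u ≡ t w → u ≡ w
      t-injective {u} {w} tu≡tw =
        toℕ-injective (ℕ.suc-injective (ι-injective {suc (toℕ u)} {suc (toℕ w)} (t<p u) (t<p w) tu≡tw))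

      t≢⊝t : ∀ u w → t u ≢ ⊝ t w
      t≢⊝t u w tu≡⊝tw = ι-suc-≢𝟘 (toℕ u ℕ.+ suc (toℕ w)) (t+t<p u w) (begin
        ι (suc (toℕ u) ℕ.+ suc (toℕ w))   ≡⟨ ι-+ (suc (toℕ u)) (suc (toℕ w)) ⟨
        t u ⊕ t w                         ≡⟨ cong (_⊕ t w) tu≡⊝tw ⟩
        ⊝ t w ⊕ t w                       ≡⟨ ⊝-inverseˡ (t w) ⟩
        𝟘                                 ∎)

      t⊗t-injective : ∀ {u w} → t u ⊗ t u ≡ t w ⊗ t w → u ≡ w
      t⊗t-injective {u} {w} eq = [ t-injective , ⊥-elim ∘ t≢⊝t u w ]′ (x⊗x≡y⊗y⇒x≡±y (t u) (t w) eq)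

      square-or-multiple : Fin h ⊎ Fin h → Zp
      square-or-multiple (inj₁ u) = t u ⊗ t u
      square-or-multiple (inj₂ u) = a ⊗ (t u ⊗ t u)

      square-or-multiple-≢𝟘 : ∀ s → square-or-multiple s ≢ 𝟘
      square-or-multiple-≢𝟘 (inj₁ u) = ⊗-≢𝟘 (t≢𝟘 u) (t≢𝟘 u)
      square-or-multiple-≢𝟘 (inj₂ u) = ⊗-≢𝟘 (nonsquare⇒≢𝟘 a-nonsquare) (⊗-≢𝟘 (t≢𝟘 u) (t≢𝟘 u))

      square≢multiple : ∀ u w → t u ⊗ t u ≢ a ⊗ (t w ⊗ t w)
      square≢multiple u w eq = a-nonsquare (square-quotient (t≢𝟘 w) (t u , eq))

      square-or-multiple-injective : ∀ {s s′} → square-or-multiple s ≡ square-or-multiple s′ → s ≡ s′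
      square-or-multiple-injective {inj₁ u} {inj₁ w} eq = cong inj₁ (t⊗t-injective eq)
      square-or-multiple-injective {inj₁ u} {inj₂ w} eq = ⊥-elim (square≢multiple u w eq)
      square-or-multiple-injective {inj₂ u} {inj₁ w} eq = ⊥-elim (square≢multiple w u (sym eq))
      square-or-multiple-injective {inj₂ u} {inj₂ w} eq =
        cong inj₂ (t⊗t-injective (⊗-cancelˡ (nonsquare⇒≢𝟘 a-nonsquare) eq))

      enumerate : Fin (suc (h ℕ.+ h)) → Zp
      enumerate fzero = 𝟘
      enumerate (fsuc j) = square-or-multiple (splitAt h j)

      enumerate-injective : ∀ {i j} → enumerate i ≡ enumerate j → i ≡ j
      enumerate-injective {fzero} {fzero} eq = refl
      enumerate-injective {fzero} {fsuc j} eq = ⊥-elim (square-or-multiple-≢𝟘 (splitAt h j) (sym eq))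
      enumerate-injective {fsuc i} {fzero} eq = ⊥-elim (square-or-multiple-≢𝟘 (splitAt h i) eq)
      enumerate-injective {fsuc i} {fsuc j} eq = cong fsuc (begin
        i                        ≡⟨ join-splitAt h h i ⟨
        join h h (splitAt h i)   ≡⟨ cong (join h h) (square-or-multiple-injective {splitAt h i} {splitAt h j} eq) ⟩
        join h h (splitAt h j)   ≡⟨ join-splitAt h h j ⟩
        j                        ∎)

      a⊗b-isSquare : ∀ b → ¬ IsSquare b → IsSquare (a ⊗ b)
      a⊗b-isSquare b b-nonsquare
        with fin-injective⇒surjective (ℕ.≤-reflexive p≡) enumerate enumerate-injective b
      ... | fzero , 𝟘≡b = ⊥-elim (b-nonsquare (𝟘 , trans (zeroˡ 𝟘) 𝟘≡b))
      ... | fsuc j , eq with splitAt h j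
      ...   | inj₁ u = ⊥-elim (b-nonsquare (t u , eq))
      ...   | inj₂ u = a ⊗ t u , (begin
        (a ⊗ t u) ⊗ (a ⊗ t u)
          ≡⟨ solve 2 (λ a t → (a :* t) :* (a :* t) := a :* (a :* (t :* t))) refl a (t u) ⟩
        a ⊗ (a ⊗ (t u ⊗ t u))
          ≡⟨ cong (a ⊗_) eq ⟩
        a ⊗ b
          ∎)

  nonsquare⊗nonsquare : ∀ {a b} → ¬ IsSquare a → ¬ IsSquare b → IsSquare (a ⊗ b)
  nonsquare⊗nonsquare {a} {b} a-nonsquare =
    Enumeration.a⊗b-isSquare a a-nonsquare (proj₁ p≡1+h+h) (proj₂ p≡1+h+h) b

module SolutionCounts (p : ℕ) .{{_ : NonZero p}} (p-prime : Prime p) (odd : ¬ 2 ∣ p) where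
  open Zmod p
  open ResidueRing p
  open ResidueSolver p using (solve; _:+_; _:-_; _:*_; :-_; _:=_; con)
  open PrimeField p p-prime
  open OddPrimeField p p-prime odd
  open Counting
  open GroupProperties +-group using (x∙y⁻¹≈ε⇒x≈y; ⁻¹-involutive)
  open AbelianGroupProperties +-abelianGroup using (⁻¹-anti-homo‿-)
  open ≡-Reasoning

  count≡countWhere : ∀ {m} (v : ZVec m) a → count v a ≡ countWhere (λ x → v x ≟ a)
  count≡countWhere v a = length-filter-tabulate (λ x → v x ≟ a) id

  count-cong : ∀ {m} {v w : ZVec m} {a b} → (∀ x → v x ≡ a → w x ≡ b) → (∀ x → w x ≡ b → v x ≡ a) →
    count v a ≡ count w b
  count-cong {v = v} {w} {a} {b} ⇒ ⇐ = begin
    count v a                   ≡⟨ count≡countWhere v a ⟩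
    countWhere (λ x → v x ≟ a)  ≡⟨ countWhere-cong (λ x → v x ≟ a) (λ x → w x ≟ b) ⇒ ⇐ ⟩
    countWhere (λ x → w x ≟ b)  ≡⟨ count≡countWhere w b ⟨
    count w b                   ∎

  count-≗ : ∀ {m} {v w : ZVec m} {a} → (∀ x → v x ≡ w x) → count v a ≡ count w a
  count-≗ v≗w = count-cong (λ x → trans (sym (v≗w x))) (λ x → trans (v≗w x))

  count-++ : ∀ m n (v : ZVec (m ℕ.+ n)) a → count v a ≡ count (v ∘ (_↑ˡ n)) a ℕ.+ count (v ∘ (m ↑ʳ_)) a
  count-++ m n v a = begin
    count v a                                                       ≡⟨ count≡countWhere v a ⟩
    countWhere (λ x → v x ≟ a)                                      ≡⟨ countWhere-↑ m n (λ x → v x ≟ a) ⟩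
    countWhere (λ x → v (x ↑ˡ n) ≟ a) ℕ.+ countWhere (λ x → v (m ↑ʳ x) ≟ a)
      ≡⟨ cong₂ ℕ._+_ (count≡countWhere (v ∘ (_↑ˡ n)) a) (count≡countWhere (v ∘ (m ↑ʳ_)) a) ⟨
    count (v ∘ (_↑ˡ n)) a ℕ.+ count (v ∘ (m ↑ʳ_)) a                 ∎

  count-unique : ∀ {m} {v : ZVec m} {a} x₀ → v x₀ ≡ a → (∀ x → v x ≡ a → x ≡ x₀) → count v a ≡ 1
  count-unique {v = v} {a} x₀ vx₀≡a unique =
    trans (count≡countWhere v a) (countWhere-unique (λ x → v x ≟ a) x₀ vx₀≡a unique)

  count-two : ∀ {m} {v : ZVec m} {a} x₀ x₁ → x₀ ≢ x₁ → v x₀ ≡ a → v x₁ ≡ a →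
    (∀ x → v x ≡ a → x ≡ x₀ ⊎ x ≡ x₁) → count v a ≡ 2
  count-two {v = v} {a} x₀ x₁ x₀≢x₁ vx₀≡a vx₁≡a two =
    trans (count≡countWhere v a) (countWhere-two (λ x → v x ≟ a) x₀ x₁ x₀≢x₁ vx₀≡a vx₁≡a two)

  count-none : ∀ {m} {v : ZVec m} {a} → (∀ x → v x ≢ a) → count v a ≡ 0
  count-none {v = v} {a} none = trans (count≡countWhere v a) (countWhere-none (λ x → v x ≟ a) none)

  count-⊖ˡ : ∀ {m} k (v : ZVec m) t → count (λ x → k ⊖ v x) t ≡ count v (k ⊖ t)
  count-⊖ˡ k v t = count-cong (λ x eq → trans (sym (k⊖[k⊖y]≡y (v x))) (cong (k ⊖_) eq))
                              (λ x eq → trans (cong (k ⊖_) eq) (k⊖[k⊖y]≡y t))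
    where
    k⊖[k⊖y]≡y : ∀ y → k ⊖ (k ⊖ y) ≡ y
    k⊖[k⊖y]≡y y = solve 2 (λ k y → k :- (k :- y) := y) refl k y

  count-⊖-swap : ∀ {m} (v w : ZVec m) t → count (λ x → v x ⊖ w x) t ≡ count (λ x → w x ⊖ v x) (⊝ t)
  count-⊖-swap v w t =
    count-cong (λ x → swap (v x) (w x) t) (λ x eq → trans (swap (w x) (v x) (⊝ t) eq) (⁻¹-involutive t))
    where
    swap : ∀ a b u → a ⊖ b ≡ u → b ⊖ a ≡ ⊝ u
    swap a b u eq = trans (sym (⁻¹-anti-homo‿- a b)) (cong ⊝_ eq)

  ⊖-⊕-cancel : ∀ x y → (x ⊖ y) ⊕ y ≡ x
  ⊖-⊕-cancel x y = solve 2 (λ x y → (x :- y) :+ y := x) refl x y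

  ⊕-⊖-cancel : ∀ x y → (x ⊕ y) ⊖ y ≡ x
  ⊕-⊖-cancel x y = solve 2 (λ x y → (x :+ y) :- y := x) refl x y

  count-affine : ∀ {s} c t → s ≢ 𝟘 → count (λ x → s ⊗ x ⊕ c) t ≡ 1
  count-affine {s} c t s≢𝟘 with s′ , s⊗s′≡𝟙 ← inverse s≢𝟘 = count-unique x₀ solves unique
    where
    x₀ = s′ ⊗ (t ⊖ c)
    s⊗x₀ : s ⊗ x₀ ≡ t ⊖ c
    s⊗x₀ = trans (sym (⊗-assoc s s′ (t ⊖ c))) (trans (cong (_⊗ (t ⊖ c)) s⊗s′≡𝟙) (⊗-identityˡ (t ⊖ c)))
    solves : s ⊗ x₀ ⊕ c ≡ t
    solves = trans (cong (_⊕ c) s⊗x₀) (⊖-⊕-cancel t c)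
    unique : ∀ x → s ⊗ x ⊕ c ≡ t → x ≡ x₀
    unique x eq = ⊗-cancelˡ s≢𝟘 (trans (sym (⊕-⊖-cancel (s ⊗ x) c)) (trans (cong (_⊖ c) eq) (sym s⊗x₀)))

  scaledSquare : Zp → Zp → Zp → Zp
  scaledSquare c h x = c ⊗ ((x ⊖ h) ⊗ (x ⊖ h))

  scaledSquare-square : ∀ c h x → c ⊗ scaledSquare c h x ≡ (c ⊗ (x ⊖ h)) ⊗ (c ⊗ (x ⊖ h))
  scaledSquare-square c h x = solve 2 (λ c y → c :* (c :* (y :* y)) := (c :* y) :* (c :* y)) refl c (x ⊖ h)

  count-scaledSquare-𝟘 : ∀ {c} h → c ≢ 𝟘 → count (scaledSquare c h) 𝟘 ≡ 1
  count-scaledSquare-𝟘 {c} h c≢𝟘 = count-unique h at-h unique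
    where
    at-h : scaledSquare c h h ≡ 𝟘
    at-h = trans (cong (λ y → c ⊗ (y ⊗ y)) (⊝-inverseʳ h)) (trans (cong (c ⊗_) (zeroˡ 𝟘)) (zeroʳ c))
    unique : ∀ x → scaledSquare c h x ≡ 𝟘 → x ≡ h
    unique x eq = x∙y⁻¹≈ε⇒x≈y x h ([ id , id ]′ (x⊗y≡𝟘⇒x≡𝟘∨y≡𝟘 (x ⊖ h) (x ⊖ h) (⊗-≡𝟘ʳ c≢𝟘 eq)))

  count-scaledSquare-nonsquare : ∀ c h Δ → ¬ IsSquare (c ⊗ Δ) → count (scaledSquare c h) Δ ≡ 0
  count-scaledSquare-nonsquare c h Δ nonsquare =
    count-none (λ x eq → nonsquare (c ⊗ (x ⊖ h) , trans (sym (scaledSquare-square c h x)) (cong (c ⊗_) eq)))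

  count-scaledSquare-square : ∀ {c} h Δ → c ≢ 𝟘 → Δ ≢ 𝟘 → IsSquare (c ⊗ Δ) → count (scaledSquare c h) Δ ≡ 2
  count-scaledSquare-square {c} h Δ c≢𝟘 Δ≢𝟘 (s , s⊗s≡c⊗Δ) with c′ , c⊗c′≡𝟙 ← inverse c≢𝟘 =
    count-two (y ⊕ h) (⊝ y ⊕ h) distinct (solves y refl)
      (solves (⊝ y) (solve 1 (λ y → (:- y) :* (:- y) := y :* y) refl y)) two
    where
    y = s ⊗ c′
    s≢𝟘 : s ≢ 𝟘
    s≢𝟘 s≡𝟘 = ⊗-≢𝟘 c≢𝟘 Δ≢𝟘 (trans (sym s⊗s≡c⊗Δ) (trans (cong (λ u → u ⊗ u) s≡𝟘) (zeroˡ 𝟘)))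
    c⊗y⊗y≡Δ : c ⊗ (y ⊗ y) ≡ Δ
    c⊗y⊗y≡Δ = begin
      c ⊗ ((s ⊗ c′) ⊗ (s ⊗ c′))
        ≡⟨ solve 3 (λ c s c′ → c :* ((s :* c′) :* (s :* c′)) := (s :* s) :* (c′ :* (c :* c′))) refl c s c′ ⟩
      (s ⊗ s) ⊗ (c′ ⊗ (c ⊗ c′))
        ≡⟨ cong₂ (λ u v → u ⊗ (c′ ⊗ v)) s⊗s≡c⊗Δ c⊗c′≡𝟙 ⟩
      (c ⊗ Δ) ⊗ (c′ ⊗ 𝟙)
        ≡⟨ solve 3 (λ c Δ c′ → (c :* Δ) :* (c′ :* con (1 , 0)) := Δ :* (c :* c′)) refl c Δ c′ ⟩
      Δ ⊗ (c ⊗ c′)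
        ≡⟨ trans (cong (Δ ⊗_) c⊗c′≡𝟙) (⊗-identityʳ Δ) ⟩
      Δ
        ∎
    solves : ∀ z → z ⊗ z ≡ y ⊗ y → scaledSquare c h (z ⊕ h) ≡ Δ
    solves z z⊗z≡y⊗y = trans (cong (λ u → c ⊗ (u ⊗ u)) (⊕-⊖-cancel z h)) (trans (cong (c ⊗_) z⊗z≡y⊗y) c⊗y⊗y≡Δ)
    distinct : y ⊕ h ≢ ⊝ y ⊕ h
    distinct eq = x≢⊝x (⊗-≢𝟘 s≢𝟘 (λ c′≡𝟘 → 𝟙≢𝟘 (trans (sym c⊗c′≡𝟙) (trans (cong (c ⊗_) c′≡𝟘) (zeroʳ c)))))
                       (trans (sym (⊕-⊖-cancel y h)) (trans (cong (_⊖ h) eq) (⊕-⊖-cancel (⊝ y) h)))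
    two : ∀ x → scaledSquare c h x ≡ Δ → x ≡ y ⊕ h ⊎ x ≡ ⊝ y ⊕ h
    two x eq = Sum.map (λ x⊖h≡y → trans (sym (⊖-⊕-cancel x h)) (cong (_⊕ h) x⊖h≡y))
                            (λ x⊖h≡⊝y → trans (sym (⊖-⊕-cancel x h)) (cong (_⊕ h) x⊖h≡⊝y))
                            (x⊗x≡y⊗y⇒x≡±y (x ⊖ h) y (⊗-cancelˡ c≢𝟘 (trans eq (sym c⊗y⊗y≡Δ))))

  count-square+count-nonsquare-multiple : ∀ {n} → ¬ IsSquare n → ∀ h₁ h₂ Δ →
    count (scaledSquare 𝟙 h₁) Δ ℕ.+ count (scaledSquare n h₂) Δ ≡ 2
  count-square+count-nonsquare-multiple {n} n-nonsquare h₁ h₂ Δ with Δ ≟ 𝟘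
  ... | yes refl =
    cong₂ ℕ._+_ (count-scaledSquare-𝟘 h₁ 𝟙≢𝟘) (count-scaledSquare-𝟘 h₂ (nonsquare⇒≢𝟘 n-nonsquare))
  ... | no Δ≢𝟘 with any? (λ s → s ⊗ s ≟ Δ)
  ...   | yes (s , s⊗s≡Δ) = cong₂ ℕ._+_
    (count-scaledSquare-square h₁ Δ 𝟙≢𝟘 Δ≢𝟘 (s , trans s⊗s≡Δ (sym (⊗-identityˡ Δ))))
    (count-scaledSquare-nonsquare n h₂ Δ λ n⊗Δ-square →
      n-nonsquare (square-quotient s≢𝟘 (subst (λ u → IsSquare (n ⊗ u)) (sym s⊗s≡Δ) n⊗Δ-square)))
    where
    s≢𝟘 : s ≢ 𝟘
    s≢𝟘 s≡𝟘 = Δ≢𝟘 (trans (sym s⊗s≡Δ) (trans (cong (λ u → u ⊗ u) s≡𝟘) (zeroˡ 𝟘)))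
  ...   | no Δ-nonsquare = cong₂ ℕ._+_
    (count-scaledSquare-nonsquare 𝟙 h₁ Δ λ (s , eq) → Δ-nonsquare (s , trans eq (⊗-identityˡ Δ)))
    (count-scaledSquare-square h₂ Δ (nonsquare⇒≢𝟘 n-nonsquare) Δ≢𝟘
                               (nonsquare⊗nonsquare n-nonsquare Δ-nonsquare))

module LinearAlgebra (p : ℕ) .{{_ : NonZero p}} (p-prime : Prime p) where
  open Zmod p
  open ResidueRing p
  open ResidueSolver p using (solve; _:+_; _:-_; _:*_; :-_; _:=_)
  open PrimeField p p-prime
  open CommutativeRing commutativeRing using (semiring)
  open SemiringSum semiring
    using (sum; sum-cong-≗; sum-replicate-zero; sum-remove; ∑-distrib-+; ∑-comm; *-distribˡ-sum; *-distribʳ-sum)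
  open ≡-Reasoning

  linComb≡sum : ∀ {r m} (c : Fin r → Zp) (u : Fin r → ZVec m) j → linComb c u j ≡ sum (λ i → c i ⊗ u i j)
  linComb≡sum {zero} c u j = refl
  linComb≡sum {suc r} c u j = cong (c fzero ⊗ u fzero j ⊕_) (linComb≡sum (c ∘ fsuc) (u ∘ fsuc) j)

  sum-≡𝟘 : ∀ {r} (f : Fin r → Zp) → (∀ i → f i ≡ 𝟘) → sum f ≡ 𝟘
  sum-≡𝟘 {r} f f≡𝟘 = trans (sum-cong-≗ f≡𝟘) (sum-replicate-zero r)

  linComb-linComb : ∀ {r s m} (c : Fin r → Zp) (U : Fin r → Fin s → Zp) (w : Fin s → ZVec m) →
    ∀ j → linComb c (λ i → linComb (U i) w) j ≡ linComb (linComb c U) w j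
  linComb-linComb c U w j = begin
    linComb c (λ i → linComb (U i) w) j
      ≡⟨ linComb≡sum c (λ i → linComb (U i) w) j ⟩
    sum (λ i → c i ⊗ linComb (U i) w j)
      ≡⟨ sum-cong-≗ (λ i → cong (c i ⊗_) (linComb≡sum (U i) w j)) ⟩
    sum (λ i → c i ⊗ sum (λ b → U i b ⊗ w b j))
      ≡⟨ sum-cong-≗ (λ i → *-distribˡ-sum (c i) (λ b → U i b ⊗ w b j)) ⟩
    sum (λ i → sum (λ b → c i ⊗ (U i b ⊗ w b j)))
      ≡⟨ ∑-comm (λ i b → c i ⊗ (U i b ⊗ w b j)) ⟩
    sum (λ b → sum (λ i → c i ⊗ (U i b ⊗ w b j)))
      ≡⟨ sum-cong-≗ (λ b → sum-cong-≗ (λ i → sym (⊗-assoc (c i) (U i b) (w b j)))) ⟩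
    sum (λ b → sum (λ i → (c i ⊗ U i b) ⊗ w b j))
      ≡⟨ sum-cong-≗ (λ b → *-distribʳ-sum (w b j) (λ i → c i ⊗ U i b)) ⟨
    sum (λ b → sum (λ i → c i ⊗ U i b) ⊗ w b j)
      ≡⟨ sum-cong-≗ (λ b → cong (_⊗ w b j) (linComb≡sum c U b)) ⟨
    sum (λ b → linComb c U b ⊗ w b j)
      ≡⟨ linComb≡sum (linComb c U) w j ⟨
    linComb (linComb c U) w j
      ∎

  sum-⊗-≡𝟘 : ∀ {r} (a z : Fin r → Zp) → (∀ i → z i ≡ 𝟘) → sum (λ i → a i ⊗ z i) ≡ 𝟘
  sum-⊗-≡𝟘 a z z≡𝟘 = sum-≡𝟘 (λ i → a i ⊗ z i) (λ i → trans (cong (a i ⊗_) (z≡𝟘 i)) (zeroʳ (a i)))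

  -- Subtracting multiples of a vector u k with nonzero first coordinate π clears the first
  -- coordinate of the other vectors; a dependency c′ of the cleared vectors lifts to u.
  private
    module Pivot {m r} (u : Fin (suc r) → Fin (suc m) → Zp) (k : Fin (suc r)) (π≢𝟘 : u k fzero ≢ 𝟘) where
      π π′ : Zp
      π = u k fzero
      π′ = proj₁ (inverse π≢𝟘)

      μ : Fin r → Zp
      μ i = u (punchIn k i) fzero ⊗ π′

      cleared : Fin r → Fin (suc m) → Zp
      cleared i b = u (punchIn k i) b ⊖ μ i ⊗ u k b

      cleared-head : ∀ i → cleared i fzero ≡ 𝟘
      cleared-head i = begin
        x ⊖ (x ⊗ π′) ⊗ π   ≡⟨ solve 3 (λ x π π′ → x :- (x :* π′) :* π := x :- x :* (π :* π′)) refl x π π′ ⟩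
        x ⊖ x ⊗ (π ⊗ π′)   ≡⟨ cong (λ y → x ⊖ x ⊗ y) (proj₂ (inverse π≢𝟘)) ⟩
        x ⊖ x ⊗ 𝟙          ≡⟨ cong (x ⊖_) (⊗-identityʳ x) ⟩
        x ⊖ x              ≡⟨ ⊝-inverseʳ x ⟩
        𝟘                  ∎
        where x = u (punchIn k i) fzero

      lift : (Fin r → Zp) → Fin (suc r) → Zp
      lift c′ = insertAt c′ k (⊝ sum (λ i → c′ i ⊗ μ i))

      lift-punchIn : ∀ c′ i → lift c′ (punchIn k i) ≡ c′ i
      lift-punchIn c′ = insertAt-punchIn c′ k (⊝ sum (λ i → c′ i ⊗ μ i))

      split-off : ∀ c x m y → c ⊗ x ≡ c ⊗ (x ⊖ m ⊗ y) ⊕ (c ⊗ m) ⊗ y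
      split-off = solve 4 (λ c x m y → c :* x := c :* (x :- m :* y) :+ (c :* m) :* y) refl

      ⊝x⊗z⊕[y⊕x⊗z]≡y : ∀ x y z → ⊝ x ⊗ z ⊕ (y ⊕ x ⊗ z) ≡ y
      ⊝x⊗z⊕[y⊕x⊗z]≡y = solve 3 (λ x y z → (:- x) :* z :+ (y :+ x :* z) := y) refl

      sum-lift : ∀ c′ b → sum (λ i → lift c′ i ⊗ u i b) ≡ sum (λ i → c′ i ⊗ cleared i b)
      sum-lift c′ b = begin
        sum (λ i → lift c′ i ⊗ u i b)
          ≡⟨ sum-remove {i = k} (λ i → lift c′ i ⊗ u i b) ⟩
        lift c′ k ⊗ u k b ⊕ sum (λ i → lift c′ (punchIn k i) ⊗ u (punchIn k i) b)
          ≡⟨ cong₂ _⊕_ (cong (_⊗ u k b) (insertAt-lookup c′ k γ))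
                       (sum-cong-≗ (λ i → cong (_⊗ u (punchIn k i) b) (lift-punchIn c′ i))) ⟩
        γ ⊗ u k b ⊕ sum (λ i → c′ i ⊗ u (punchIn k i) b)
          ≡⟨ cong (γ ⊗ u k b ⊕_) (sum-cong-≗ λ i → split-off (c′ i) (u (punchIn k i) b) (μ i) (u k b)) ⟩
        γ ⊗ u k b ⊕ sum (λ i → c′ i ⊗ cleared i b ⊕ (c′ i ⊗ μ i) ⊗ u k b)
          ≡⟨ cong (γ ⊗ u k b ⊕_) (∑-distrib-+ (λ i → c′ i ⊗ cleared i b) (λ i → (c′ i ⊗ μ i) ⊗ u k b)) ⟩
        γ ⊗ u k b ⊕ (sum (λ i → c′ i ⊗ cleared i b) ⊕ sum (λ i → (c′ i ⊗ μ i) ⊗ u k b))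
          ≡⟨ cong (λ y → γ ⊗ u k b ⊕ (sum (λ i → c′ i ⊗ cleared i b) ⊕ y))
                  (*-distribʳ-sum (u k b) (λ i → c′ i ⊗ μ i)) ⟨
        γ ⊗ u k b ⊕ (sum (λ i → c′ i ⊗ cleared i b) ⊕ sum (λ i → c′ i ⊗ μ i) ⊗ u k b)
          ≡⟨ ⊝x⊗z⊕[y⊕x⊗z]≡y (sum (λ i → c′ i ⊗ μ i)) (sum (λ i → c′ i ⊗ cleared i b)) (u k b) ⟩
        sum (λ i → c′ i ⊗ cleared i b)
          ∎
        where γ = ⊝ sum (λ i → c′ i ⊗ μ i)

  more-vectors⇒dependent : ∀ {m r} → m ℕ.< r → (u : Fin r → Fin m → Zp) →
    Σ (Fin r → Zp) λ c → (∀ b → sum (λ i → c i ⊗ u i b) ≡ 𝟘) × Σ (Fin r) (λ i → c i ≢ 𝟘)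
  more-vectors⇒dependent {zero} {suc r} _ u = (λ _ → 𝟙) , (λ ()) , fzero , 𝟙≢𝟘
  more-vectors⇒dependent {suc m} {suc r} (ℕ.s≤s m<r) u with any? (λ k → ¬? (u k fzero ≟ 𝟘))
  ... | no no-pivot
    with c , dependency , i , cᵢ≢𝟘 ← more-vectors⇒dependent (ℕ.m<n⇒m<1+n m<r) (λ i b → u i (fsuc b))
    = c , (λ { fzero → sum-⊗-≡𝟘 c (λ i → u i fzero) head≡𝟘 ; (fsuc b) → dependency b }) , i , cᵢ≢𝟘
    where
    head≡𝟘 : ∀ i → u i fzero ≡ 𝟘
    head≡𝟘 i = decidable-stable (u i fzero ≟ 𝟘) (λ u≢𝟘 → no-pivot (i , u≢𝟘))
  ... | yes (k , π≢𝟘)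
    with c′ , dependency , i , c′ᵢ≢𝟘 ← more-vectors⇒dependent m<r (λ i b → Pivot.cleared u k π≢𝟘 i (fsuc b))
    = lift c′
    , (λ { fzero → trans (sum-lift c′ fzero) (sum-⊗-≡𝟘 c′ (λ i → cleared i fzero) cleared-head)
         ; (fsuc b) → trans (sum-lift c′ (fsuc b)) (dependency b) })
    , punchIn k i , λ liftᵢ≡𝟘 → c′ᵢ≢𝟘 (trans (sym (lift-punchIn c′ i)) liftᵢ≡𝟘)
    where open Pivot u k π≢𝟘

  ≡𝟘-by-vanishing-combination : ∀ {r k x} (a z : Fin r → Zp) → k ≢ 𝟘 → (∀ i → z i ≡ 𝟘) →
    k ⊗ x ≡ sum (λ i → a i ⊗ z i) → x ≡ 𝟘
  ≡𝟘-by-vanishing-combination a z k≢𝟘 z≡𝟘 eq = ⊗-≡𝟘ʳ k≢𝟘 (trans eq (sum-⊗-≡𝟘 a z z≡𝟘))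

  module _ {r s m} {u : Fin r → ZVec m} (U : Fin r → Fin s → Zp) (w : Fin s → ZVec m)
           (u≡U·w : ∀ i j → u i j ≡ linComb (U i) w j) where

    linComb-coordinates : ∀ c j → linComb c u j ≡ linComb (linComb c U) w j
    linComb-coordinates c j = begin
      linComb c u j                           ≡⟨ linComb≡sum c u j ⟩
      sum (λ i → c i ⊗ u i j)                 ≡⟨ sum-cong-≗ (λ i → cong (c i ⊗_) (u≡U·w i j)) ⟩
      sum (λ i → c i ⊗ linComb (U i) w j)     ≡⟨ linComb≡sum c (λ i → linComb (U i) w) j ⟨
      linComb c (λ i → linComb (U i) w) j     ≡⟨ linComb-linComb c U w j ⟩
      linComb (linComb c U) w j               ∎

    dependent-coordinates : s ℕ.< r → ¬ LinearlyIndependent u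
    dependent-coordinates s<r independent with c , dependency , i , cᵢ≢𝟘 ← more-vectors⇒dependent s<r U =
      cᵢ≢𝟘 (independent c (λ j → begin
        linComb c u j                 ≡⟨ linComb-coordinates c j ⟩
        linComb (linComb c U) w j     ≡⟨ linComb≡sum (linComb c U) w j ⟩
        sum (λ b → linComb c U b ⊗ w b j)
          ≡⟨ sum-≡𝟘 (λ b → linComb c U b ⊗ w b j)
                    (λ b → trans (cong (_⊗ w b j) (trans (linComb≡sum c U b) (dependency b))) (zeroˡ (w b j))) ⟩
        𝟘                             ∎) i)

    independent-coordinates : LinearlyIndependent U → LinearlyIndependent w → LinearlyIndependent u
    independent-coordinates U-independent w-independent c u-dependency =
      U-independent c (w-independent (linComb c U)
        (λ j → trans (sym (linComb-coordinates c j)) (u-dependency j)))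

module Matrix (p : ℕ) .{{_ : NonZero p}} (p-prime : Prime p) (odd : ¬ 2 ∣ p)
              (n α β : Zmod.Zp p) (n-nonsquare : Zmod.NonSquare p n) where
  open Zmod p
  open ResidueRing p
  open ResidueSolver p using (solve; _:+_; _:-_; _:*_; :-_; _:=_; con; Polynomial)
  open PrimeField p p-prime
  open OddPrimeField p p-prime odd
  open SolutionCounts p p-prime odd
  open GroupProperties +-group using (x∙y⁻¹≈ε⇒x≈y)
  open LinearAlgebra p p-prime
    using (≡𝟘-by-vanishing-combination; dependent-coordinates; independent-coordinates)
  open CommutativeRing commutativeRing using (semiring)
  open SemiringSum semiring using (sum)
  open ≡-Reasoning

  -- Rows and columns of 𝕃′ are indexed by Fin p ⊎ Fin p through splitAt p: inj₁ k is
  -- the row L′ₖ (resp. the column k of the first half), inj₂ k is L′ₖ₊ₚ (resp. p + k).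
  entry : Fin p ⊎ Fin p → Fin p ⊎ Fin p → Zp
  entry (inj₁ k) (inj₁ x) = (𝟚 ⊗ k) ⊗ x ⊕ (k ⊗ k) ⊗ (α ⊖ 𝟙)
  entry (inj₁ k) (inj₂ x) = (𝟚 ⊗ k) ⊗ (n ⊗ x) ⊕ (k ⊗ k) ⊗ (α ⊖ n)
  entry (inj₂ l) (inj₁ x) = (x ⊗ x ⊖ (𝟚 ⊗ n ⊗ l) ⊗ x) ⊕ (l ⊗ l) ⊗ (β ⊕ n ⊗ n)
  entry (inj₂ l) (inj₂ x) = (n ⊗ (x ⊗ x) ⊖ (𝟚 ⊗ n ⊗ l) ⊗ x) ⊕ (l ⊗ l) ⊗ (β ⊕ n)

  v₁x≡x : ∀ x → v₁ x ≡ x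
  v₁x≡x = ι-toℕ

  v₂x≡x⊗x : ∀ x → v₂ x ≡ x ⊗ x
  v₂x≡x⊗x x = trans (sym (ι-* (toℕ x) (toℕ x))) (cong₂ _⊗_ (ι-toℕ x) (ι-toℕ x))

  L′≡entry : ∀ i j → L′ n α β i j ≡ entry (splitAt p i) (splitAt p j)
  L′≡entry i j with splitAt p i
  ... | inj₁ k with splitAt p j
  ...   | inj₁ x rewrite v₁x≡x x | ⊗-identityʳ (α ⊖ 𝟙) = refl
  ...   | inj₂ x rewrite v₁x≡x x | ⊗-identityʳ (α ⊖ n) = refl
  L′≡entry i j | inj₂ l with splitAt p j
  ...   | inj₁ x rewrite v₁x≡x x | v₂x≡x⊗x x | ⊗-identityʳ (β ⊕ n ⊗ n) = refl
  ...   | inj₂ x rewrite v₁x≡x x | v₂x≡x⊗x x | ⊗-identityʳ (β ⊕ n) = refl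

  -- Solver expressions whose denotations unfold to entry, basisEntry, combination and
  -- coordinates, so that solver goals can be stated through these definitions.
  private
    module Expressions {m} (n α : Polynomial m) where
      𝟙ᵉ 𝟚ᵉ : Polynomial m
      𝟙ᵉ = con (1 , 0)
      𝟚ᵉ = con (2 , 0)

      entryᵉ₁₁ entryᵉ₁₂ : Polynomial m → Polynomial m → Polynomial m
      entryᵉ₁₁ k x = (𝟚ᵉ :* k) :* x :+ (k :* k) :* (α :- 𝟙ᵉ)
      entryᵉ₁₂ k x = (𝟚ᵉ :* k) :* (n :* x) :+ (k :* k) :* (α :- n)

      entryᵉ₂₁ entryᵉ₂₂ : Polynomial m → Polynomial m → Polynomial m → Polynomial m
      entryᵉ₂₁ γ l x = (x :* x :- (𝟚ᵉ :* n :* l) :* x) :+ (l :* l) :* γ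
      entryᵉ₂₂ γ l x = (n :* (x :* x) :- (𝟚ᵉ :* n :* l) :* x) :+ (l :* l) :* γ

      squareᵉ : Polynomial m → Polynomial m
      squareᵉ y = y :* y

      mixed-constantᵉ : Polynomial m → Polynomial m → Polynomial m → Polynomial m
      mixed-constantᵉ β k l = squareᵉ (k :+ n :* l) :+ ((k :* k) :* (α :- 𝟙ᵉ) :- (l :* l) :* (β :+ n :* n))

      𝟘ᵉ : Polynomial m
      𝟘ᵉ = con (0 , 0)

      sumᵉ : ∀ {r} → (Fin r → Polynomial m) → Polynomial m
      sumᵉ {zero} f = 𝟘ᵉ
      sumᵉ {suc r} f = f fzero :+ sumᵉ (f ∘ fsuc)

      basisEntryᵉ : Fin 4 → Polynomial m ⊎ Polynomial m → Polynomial m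
      basisEntryᵉ fzero (inj₁ x) = x
      basisEntryᵉ fzero (inj₂ x) = n :* x
      basisEntryᵉ (fsuc fzero) (inj₁ x) = α :- 𝟙ᵉ
      basisEntryᵉ (fsuc fzero) (inj₂ x) = α :- n
      basisEntryᵉ (fsuc (fsuc fzero)) (inj₁ x) = x :* x
      basisEntryᵉ (fsuc (fsuc fzero)) (inj₂ x) = n :* (x :* x)
      basisEntryᵉ (fsuc (fsuc (fsuc fzero))) (inj₁ x) = x
      basisEntryᵉ (fsuc (fsuc (fsuc fzero))) (inj₂ x) = x

      combinationᵉ : (Fin 4 → Polynomial m) → Polynomial m ⊎ Polynomial m → Polynomial m
      combinationᵉ c s = sumᵉ (λ b → c b :* basisEntryᵉ b s)

      samplesᵉ : Fin 5 → Polynomial m ⊎ Polynomial m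
      samplesᵉ = inj₁ 𝟘ᵉ ∷ inj₂ 𝟘ᵉ ∷ inj₁ 𝟙ᵉ ∷ inj₁ (:- 𝟙ᵉ) ∷ inj₂ 𝟙ᵉ ∷ []

      rowsᵉ : Fin 4 → Polynomial m ⊎ Polynomial m
      rowsᵉ = inj₁ 𝟙ᵉ ∷ inj₁ (:- 𝟙ᵉ) ∷ inj₂ 𝟘ᵉ ∷ inj₂ 𝟙ᵉ ∷ []

      coordinatesᵉ : Polynomial m ⊎ Polynomial m → Fin 4 → Polynomial m
      coordinatesᵉ (inj₁ k) = 𝟚ᵉ :* k ∷ k :* k ∷ 𝟘ᵉ ∷ 𝟘ᵉ ∷ []
      coordinatesᵉ (inj₂ l) = 𝟘ᵉ ∷ n :* (l :* l) ∷ 𝟙ᵉ ∷ :- (𝟚ᵉ :* n :* l) ∷ []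

      sampledᵉ : (Fin 5 → Polynomial m) → (Fin 4 → Polynomial m) → Polynomial m
      sampledᵉ a c = sumᵉ (λ i → a i :* combinationᵉ c (samplesᵉ i))

      coordinate-sumᵉ : (Fin 4 → Polynomial m) → (Fin 4 → Polynomial m) → Polynomial m
      coordinate-sumᵉ a c = sumᵉ (λ b → a b :* sumᵉ (λ i → c i :* coordinatesᵉ (rowsᵉ i) b))

  differenceˡ differenceʳ : Fin p ⊎ Fin p → Fin p ⊎ Fin p → ZVec p
  differenceˡ R R′ x = entry R (inj₁ x) ⊖ entry R′ (inj₁ x)
  differenceʳ R R′ x = entry R (inj₂ x) ⊖ entry R′ (inj₂ x)

  differenceˡ-₁₁ : ∀ k l x →
    differenceˡ (inj₁ k) (inj₁ l) x ≡ (𝟚 ⊗ (k ⊖ l)) ⊗ x ⊕ (k ⊗ k ⊖ l ⊗ l) ⊗ (α ⊖ 𝟙)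
  differenceˡ-₁₁ k l x = solve 6 (λ k l x n α β → let open Expressions n α in
    entryᵉ₁₁ k x :- entryᵉ₁₁ l x
      := (𝟚ᵉ :* (k :- l)) :* x :+ (k :* k :- l :* l) :* (α :- 𝟙ᵉ))
    refl k l x n α β

  differenceʳ-₁₁ : ∀ k l x →
    differenceʳ (inj₁ k) (inj₁ l) x ≡ (𝟚 ⊗ n ⊗ (k ⊖ l)) ⊗ x ⊕ (k ⊗ k ⊖ l ⊗ l) ⊗ (α ⊖ n)
  differenceʳ-₁₁ k l x = solve 6 (λ k l x n α β → let open Expressions n α in
    entryᵉ₁₂ k x :- entryᵉ₁₂ l x
      := (𝟚ᵉ :* n :* (k :- l)) :* x :+ (k :* k :- l :* l) :* (α :- n))
    refl k l x n α β

  differenceˡ-₂₂ : ∀ k l x →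
    differenceˡ (inj₂ k) (inj₂ l) x ≡ (𝟚 ⊗ n ⊗ (l ⊖ k)) ⊗ x ⊕ (k ⊗ k ⊖ l ⊗ l) ⊗ (β ⊕ n ⊗ n)
  differenceˡ-₂₂ k l x = solve 6 (λ k l x n α β → let open Expressions n α in
    entryᵉ₂₁ (β :+ n :* n) k x :- entryᵉ₂₁ (β :+ n :* n) l x
      := (𝟚ᵉ :* n :* (l :- k)) :* x :+ (k :* k :- l :* l) :* (β :+ n :* n))
    refl k l x n α β

  differenceʳ-₂₂ : ∀ k l x →
    differenceʳ (inj₂ k) (inj₂ l) x ≡ (𝟚 ⊗ n ⊗ (l ⊖ k)) ⊗ x ⊕ (k ⊗ k ⊖ l ⊗ l) ⊗ (β ⊕ n)
  differenceʳ-₂₂ k l x = solve 6 (λ k l x n α β → let open Expressions n α in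
    entryᵉ₂₂ (β :+ n) k x :- entryᵉ₂₂ (β :+ n) l x
      := (𝟚ᵉ :* n :* (l :- k)) :* x :+ (k :* k :- l :* l) :* (β :+ n))
    refl k l x n α β

  -- The constant left by completing the square in either half of a difference of rows
  -- from different blocks.
  mixed-constant : Zp → Zp → Zp
  mixed-constant k l = (k ⊕ n ⊗ l) ⊗ (k ⊕ n ⊗ l) ⊕ ((k ⊗ k) ⊗ (α ⊖ 𝟙) ⊖ (l ⊗ l) ⊗ (β ⊕ n ⊗ n))

  differenceˡ-₁₂ : ∀ k l x →
    differenceˡ (inj₁ k) (inj₂ l) x ≡ mixed-constant k l ⊖ scaledSquare 𝟙 (k ⊕ n ⊗ l) x
  differenceˡ-₁₂ k l x = solve 6 (λ k l x n α β → let open Expressions n α in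
    entryᵉ₁₁ k x :- entryᵉ₂₁ (β :+ n :* n) l x
      := mixed-constantᵉ β k l :- 𝟙ᵉ :* squareᵉ (x :- (k :+ n :* l)))
    refl k l x n α β

  differenceʳ-₁₂ : ∀ k l x →
    differenceʳ (inj₁ k) (inj₂ l) x ≡ mixed-constant k l ⊖ scaledSquare n (k ⊕ l) x
  differenceʳ-₁₂ k l x = solve 6 (λ k l x n α β → let open Expressions n α in
    entryᵉ₁₂ k x :- entryᵉ₂₂ (β :+ n) l x
      := mixed-constantᵉ β k l :- n :* squareᵉ (x :- (k :+ l)))
    refl k l x n α β

  n≢𝟘 : n ≢ 𝟘
  n≢𝟘 = nonsquare⇒≢𝟘 n-nonsquare

  ⊖-≢𝟘 : ∀ {k l} → k ≢ l → k ⊖ l ≢ 𝟘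
  ⊖-≢𝟘 {k} {l} k≢l k⊖l≡𝟘 = k≢l (x∙y⁻¹≈ε⇒x≈y k l k⊖l≡𝟘)

  count-differences : ∀ R R′ → R ≢ R′ → ∀ t → count (differenceˡ R R′) t ℕ.+ count (differenceʳ R R′) t ≡ 2
  count-differences (inj₁ k) (inj₁ l) R≢R′ t = cong₂ ℕ._+_
    (trans (count-≗ (differenceˡ-₁₁ k l)) (count-affine _ t (⊗-≢𝟘 𝟚≢𝟘 k⊖l≢𝟘)))
    (trans (count-≗ (differenceʳ-₁₁ k l)) (count-affine _ t (⊗-≢𝟘 (⊗-≢𝟘 𝟚≢𝟘 n≢𝟘) k⊖l≢𝟘)))
    where k⊖l≢𝟘 = ⊖-≢𝟘 (R≢R′ ∘ cong inj₁)
  count-differences (inj₂ k) (inj₂ l) R≢R′ t = cong₂ ℕ._+_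
    (trans (count-≗ (differenceˡ-₂₂ k l)) (count-affine _ t (⊗-≢𝟘 (⊗-≢𝟘 𝟚≢𝟘 n≢𝟘) l⊖k≢𝟘)))
    (trans (count-≗ (differenceʳ-₂₂ k l)) (count-affine _ t (⊗-≢𝟘 (⊗-≢𝟘 𝟚≢𝟘 n≢𝟘) l⊖k≢𝟘)))
    where l⊖k≢𝟘 = ⊖-≢𝟘 (R≢R′ ∘ cong inj₂ ∘ sym)
  count-differences (inj₁ k) (inj₂ l) _ t = begin
    count (differenceˡ (inj₁ k) (inj₂ l)) t ℕ.+ count (differenceʳ (inj₁ k) (inj₂ l)) t
      ≡⟨ cong₂ ℕ._+_ (trans (count-≗ (differenceˡ-₁₂ k l)) (count-⊖ˡ K (scaledSquare 𝟙 (k ⊕ n ⊗ l)) t))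
                     (trans (count-≗ (differenceʳ-₁₂ k l)) (count-⊖ˡ K (scaledSquare n (k ⊕ l)) t)) ⟩
    count (scaledSquare 𝟙 (k ⊕ n ⊗ l)) (K ⊖ t) ℕ.+ count (scaledSquare n (k ⊕ l)) (K ⊖ t)
      ≡⟨ count-square+count-nonsquare-multiple n-nonsquare (k ⊕ n ⊗ l) (k ⊕ l) (K ⊖ t) ⟩
    2 ∎
    where K = mixed-constant k l
  count-differences (inj₂ l) (inj₁ k) _ t = trans
    (cong₂ ℕ._+_ (count-⊖-swap (λ x → entry (inj₂ l) (inj₁ x)) (λ x → entry (inj₁ k) (inj₁ x)) t)
                 (count-⊖-swap (λ x → entry (inj₂ l) (inj₂ x)) (λ x → entry (inj₁ k) (inj₂ x)) t))
    (count-differences (inj₁ k) (inj₂ l) (λ ()) (⊝ t))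

  splitAt-injective : ∀ {i j : Fin (p ℕ.+ p)} → splitAt p i ≡ splitAt p j → i ≡ j
  splitAt-injective {i} {j} eq =
    trans (sym (join-splitAt p p i)) (trans (cong (join p p) eq) (join-splitAt p p j))

  L′-left : ∀ i x → L′ n α β i (x ↑ˡ p) ≡ entry (splitAt p i) (inj₁ x)
  L′-left i x = trans (L′≡entry i (x ↑ˡ p)) (cong (entry (splitAt p i)) (splitAt-↑ˡ p x p))

  L′-right : ∀ i x → L′ n α β i (p ↑ʳ x) ≡ entry (splitAt p i) (inj₂ x)
  L′-right i x = trans (L′≡entry i (p ↑ʳ x)) (cong (entry (splitAt p i)) (splitAt-↑ʳ p p x))

  count-row-difference : ∀ {i j} → i ≢ j → ∀ t → count (L′ n α β i -ᵥ L′ n α β j) t ≡ 2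
  count-row-difference {i} {j} i≢j t = begin
    count (L′ n α β i -ᵥ L′ n α β j) t
      ≡⟨ count-++ p p (L′ n α β i -ᵥ L′ n α β j) t ⟩
    count (λ x → L′ n α β i (x ↑ˡ p) ⊖ L′ n α β j (x ↑ˡ p)) t
      ℕ.+ count (λ x → L′ n α β i (p ↑ʳ x) ⊖ L′ n α β j (p ↑ʳ x)) t
      ≡⟨ cong₂ ℕ._+_ (count-≗ (λ x → cong₂ _⊖_ (L′-left i x) (L′-left j x)))
                     (count-≗ (λ x → cong₂ _⊖_ (L′-right i x) (L′-right j x))) ⟩
    count (differenceˡ (splitAt p i) (splitAt p j)) t ℕ.+ count (differenceʳ (splitAt p i) (splitAt p j)) t
      ≡⟨ count-differences (splitAt p i) (splitAt p j) (i≢j ∘ splitAt-injective) t ⟩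
    2 ∎

  L′-logHadamard : LogHadamard (L′ n α β)
  L′-logHadamard i j i≢j a b = trans (count-row-difference i≢j a) (sym (count-row-difference i≢j b))

  basisEntry : Fin 4 → Fin p ⊎ Fin p → Zp
  basisEntry fzero (inj₁ x) = x
  basisEntry fzero (inj₂ x) = n ⊗ x
  basisEntry (fsuc fzero) (inj₁ x) = α ⊖ 𝟙
  basisEntry (fsuc fzero) (inj₂ x) = α ⊖ n
  basisEntry (fsuc (fsuc fzero)) (inj₁ x) = x ⊗ x
  basisEntry (fsuc (fsuc fzero)) (inj₂ x) = n ⊗ (x ⊗ x)
  basisEntry (fsuc (fsuc (fsuc fzero))) (inj₁ x) = x
  basisEntry (fsuc (fsuc (fsuc fzero))) (inj₂ x) = x

  basis : Fin 4 → ZVec (p ℕ.+ p)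
  basis b j = basisEntry b (splitAt p j)

  combination : (Fin 4 → Zp) → Fin p ⊎ Fin p → Zp
  combination c s = sum (λ b → c b ⊗ basisEntry b s)

  coordinates : Fin p ⊎ Fin p → Fin 4 → Zp
  coordinates (inj₁ k) = 𝟚 ⊗ k ∷ k ⊗ k ∷ 𝟘 ∷ 𝟘 ∷ []
  coordinates (inj₂ l) = 𝟘 ∷ n ⊗ (l ⊗ l) ∷ 𝟙 ∷ ⊝ (𝟚 ⊗ n ⊗ l) ∷ []

  n⊖𝟙≢𝟘 : n ⊖ 𝟙 ≢ 𝟘
  n⊖𝟙≢𝟘 n⊖𝟙≡𝟘 = n-nonsquare (𝟙 , trans (⊗-identityˡ 𝟙) (sym (x∙y⁻¹≈ε⇒x≈y n 𝟙 n⊖𝟙≡𝟘)))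

  samples : Fin 5 → Fin p ⊎ Fin p
  samples = inj₁ 𝟘 ∷ inj₂ 𝟘 ∷ inj₁ 𝟙 ∷ inj₁ (⊝ 𝟙) ∷ inj₂ 𝟙 ∷ []

  -- Each coefficient vector expresses a nonzero multiple of cᵢ through the values of the
  -- combination at the five sample columns (a hand solution of that linear system).
  basis-independent : LinearlyIndependent basis
  basis-independent c vanishes = λ
    { fzero → from-samples (𝟚 ⊗ n ∷ ⊝ 𝟚 ∷ ⊝ (𝟙 ⊕ n) ∷ 𝟙 ⊖ n ∷ 𝟚 ∷ []) (⊗-≢𝟘 𝟚≢𝟘 n⊖𝟙≢𝟘)
        (solve 6 (λ c₀ c₁ c₂ c₃ α n → let open Expressions n α in
          (𝟚ᵉ :* (n :- 𝟙ᵉ)) :* c₀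
            := sampledᵉ (𝟚ᵉ :* n ∷ :- 𝟚ᵉ ∷ :- (𝟙ᵉ :+ n) ∷ 𝟙ᵉ :- n ∷ 𝟚ᵉ ∷ []) (c₀ ∷ c₁ ∷ c₂ ∷ c₃ ∷ []))
          refl c₀ c₁ c₂ c₃ α n)
    ; (fsuc fzero) → from-samples (𝟙 ∷ ⊝ 𝟙 ∷ 𝟘 ∷ 𝟘 ∷ 𝟘 ∷ []) n⊖𝟙≢𝟘
        (solve 6 (λ c₀ c₁ c₂ c₃ α n → let open Expressions n α in
          (n :- 𝟙ᵉ) :* c₁ := sampledᵉ (𝟙ᵉ ∷ :- 𝟙ᵉ ∷ 𝟘ᵉ ∷ 𝟘ᵉ ∷ 𝟘ᵉ ∷ []) (c₀ ∷ c₁ ∷ c₂ ∷ c₃ ∷ []))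
          refl c₀ c₁ c₂ c₃ α n)
    ; (fsuc (fsuc fzero)) → from-samples (⊝ 𝟚 ∷ 𝟘 ∷ 𝟙 ∷ 𝟙 ∷ 𝟘 ∷ []) 𝟚≢𝟘
        (solve 6 (λ c₀ c₁ c₂ c₃ α n → let open Expressions n α in
          𝟚ᵉ :* c₂ := sampledᵉ (:- 𝟚ᵉ ∷ 𝟘ᵉ ∷ 𝟙ᵉ ∷ 𝟙ᵉ ∷ 𝟘ᵉ ∷ []) (c₀ ∷ c₁ ∷ c₂ ∷ c₃ ∷ []))
          refl c₀ c₁ c₂ c₃ α n)
    ; (fsuc (fsuc (fsuc fzero))) → from-samples (⊝ n ∷ 𝟙 ∷ n ∷ 𝟘 ∷ ⊝ 𝟙 ∷ []) n⊖𝟙≢𝟘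
        (solve 6 (λ c₀ c₁ c₂ c₃ α n → let open Expressions n α in
          (n :- 𝟙ᵉ) :* c₃ := sampledᵉ (:- n ∷ 𝟙ᵉ ∷ n ∷ 𝟘ᵉ ∷ :- 𝟙ᵉ ∷ []) (c₀ ∷ c₁ ∷ c₂ ∷ c₃ ∷ []))
          refl c₀ c₁ c₂ c₃ α n) }
    where
    c₀ = c fzero
    c₁ = c (fsuc fzero)
    c₂ = c (fsuc (fsuc fzero))
    c₃ = c (fsuc (fsuc (fsuc fzero)))
    sampled : Fin 5 → Zp
    sampled i = combination c (samples i)
    sampled-vanishes : ∀ i → sampled i ≡ 𝟘
    sampled-vanishes i =
      trans (cong (combination c) (sym (splitAt-join p p (samples i)))) (vanishes (join p p (samples i)))
    from-samples : ∀ {k x} (a : Fin 5 → Zp) → k ≢ 𝟘 → k ⊗ x ≡ sum (λ i → a i ⊗ sampled i) → x ≡ 𝟘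
    from-samples a k≢𝟘 = ≡𝟘-by-vanishing-combination a sampled k≢𝟘 sampled-vanishes

  rows : Fin 4 → Fin p ⊎ Fin p
  rows = inj₁ 𝟙 ∷ inj₁ (⊝ 𝟙) ∷ inj₂ 𝟘 ∷ inj₂ 𝟙 ∷ []

  coordinates-independent : LinearlyIndependent (λ i → coordinates (rows i))
  coordinates-independent c vanishes = λ
    { fzero → from-coordinates (𝟙 ∷ 𝟚 ∷ 𝟘 ∷ 𝟙 ∷ []) (⊗-≢𝟘 𝟚≢𝟘 𝟚≢𝟘)
        (solve 6 (λ c₀ c₁ c₂ c₃ α n → let open Expressions n α in
          (𝟚ᵉ :* 𝟚ᵉ) :* c₀ := coordinate-sumᵉ (𝟙ᵉ ∷ 𝟚ᵉ ∷ 𝟘ᵉ ∷ 𝟙ᵉ ∷ []) (c₀ ∷ c₁ ∷ c₂ ∷ c₃ ∷ []))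
          refl c₀ c₁ c₂ c₃ α n)
    ; (fsuc fzero) → from-coordinates (⊝ 𝟙 ∷ 𝟚 ∷ 𝟘 ∷ 𝟙 ∷ []) (⊗-≢𝟘 𝟚≢𝟘 𝟚≢𝟘)
        (solve 6 (λ c₀ c₁ c₂ c₃ α n → let open Expressions n α in
          (𝟚ᵉ :* 𝟚ᵉ) :* c₁ := coordinate-sumᵉ (:- 𝟙ᵉ ∷ 𝟚ᵉ ∷ 𝟘ᵉ ∷ 𝟙ᵉ ∷ []) (c₀ ∷ c₁ ∷ c₂ ∷ c₃ ∷ []))
          refl c₀ c₁ c₂ c₃ α n)
    ; (fsuc (fsuc fzero)) → from-coordinates (𝟘 ∷ 𝟘 ∷ 𝟚 ⊗ n ∷ 𝟙 ∷ []) (⊗-≢𝟘 𝟚≢𝟘 n≢𝟘)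
        (solve 6 (λ c₀ c₁ c₂ c₃ α n → let open Expressions n α in
          (𝟚ᵉ :* n) :* c₂ := coordinate-sumᵉ (𝟘ᵉ ∷ 𝟘ᵉ ∷ 𝟚ᵉ :* n ∷ 𝟙ᵉ ∷ []) (c₀ ∷ c₁ ∷ c₂ ∷ c₃ ∷ []))
          refl c₀ c₁ c₂ c₃ α n)
    ; (fsuc (fsuc (fsuc fzero))) → from-coordinates (𝟘 ∷ 𝟘 ∷ 𝟘 ∷ ⊝ 𝟙 ∷ []) (⊗-≢𝟘 𝟚≢𝟘 n≢𝟘)
        (solve 6 (λ c₀ c₁ c₂ c₃ α n → let open Expressions n α in
          (𝟚ᵉ :* n) :* c₃ := coordinate-sumᵉ (𝟘ᵉ ∷ 𝟘ᵉ ∷ 𝟘ᵉ ∷ :- 𝟙ᵉ ∷ []) (c₀ ∷ c₁ ∷ c₂ ∷ c₃ ∷ []))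
          refl c₀ c₁ c₂ c₃ α n) }
    where
    c₀ = c fzero
    c₁ = c (fsuc fzero)
    c₂ = c (fsuc (fsuc fzero))
    c₃ = c (fsuc (fsuc (fsuc fzero)))
    from-coordinates : ∀ {k x} (a : Fin 4 → Zp) → k ≢ 𝟘 →
      k ⊗ x ≡ sum (λ b → a b ⊗ linComb c (λ i → coordinates (rows i)) b) → x ≡ 𝟘
    from-coordinates a k≢𝟘 =
      ≡𝟘-by-vanishing-combination a (linComb c (λ i → coordinates (rows i))) k≢𝟘 vanishes

  module _ (β-relation : (β ⊖ n ⊗ α) ⊕ (n ⊗ n ⊕ n) ≡ 𝟘) where
    β⊕n⊗n≡n⊗[α⊖𝟙] : β ⊕ n ⊗ n ≡ n ⊗ (α ⊖ 𝟙)
    β⊕n⊗n≡n⊗[α⊖𝟙] = x∙y⁻¹≈ε⇒x≈y (β ⊕ n ⊗ n) (n ⊗ (α ⊖ 𝟙)) (trans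
      (solve 3 (λ α β n → let open Expressions n α in
        (β :+ n :* n) :- n :* (α :- 𝟙ᵉ) := (β :- n :* α) :+ (n :* n :+ n)) refl α β n) β-relation)

    β⊕n≡n⊗[α⊖n] : β ⊕ n ≡ n ⊗ (α ⊖ n)
    β⊕n≡n⊗[α⊖n] = x∙y⁻¹≈ε⇒x≈y (β ⊕ n) (n ⊗ (α ⊖ n)) (trans
      (solve 3 (λ α β n → (β :+ n) :- n :* (α :- n) := (β :- n :* α) :+ (n :* n :+ n)) refl α β n) β-relation)

    entry≡combination : ∀ R s → entry R s ≡ combination (coordinates R) s
    entry≡combination (inj₁ k) (inj₁ x) = solve 4 (λ k x n α → let open Expressions n α in
      entryᵉ₁₁ k x := combinationᵉ (coordinatesᵉ (inj₁ k)) (inj₁ x)) refl k x n α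
    entry≡combination (inj₁ k) (inj₂ x) = solve 4 (λ k x n α → let open Expressions n α in
      entryᵉ₁₂ k x := combinationᵉ (coordinatesᵉ (inj₁ k)) (inj₂ x)) refl k x n α
    entry≡combination (inj₂ l) (inj₁ x) =
      trans (cong (λ γ → (x ⊗ x ⊖ (𝟚 ⊗ n ⊗ l) ⊗ x) ⊕ (l ⊗ l) ⊗ γ) β⊕n⊗n≡n⊗[α⊖𝟙])
      (solve 4 (λ l x n α → let open Expressions n α in
        entryᵉ₂₁ (n :* (α :- 𝟙ᵉ)) l x := combinationᵉ (coordinatesᵉ (inj₂ l)) (inj₁ x)) refl l x n α)
    entry≡combination (inj₂ l) (inj₂ x) =
      trans (cong (λ γ → (n ⊗ (x ⊗ x) ⊖ (𝟚 ⊗ n ⊗ l) ⊗ x) ⊕ (l ⊗ l) ⊗ γ) β⊕n≡n⊗[α⊖n])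
      (solve 4 (λ l x n α → let open Expressions n α in
        entryᵉ₂₂ (n :* (α :- n)) l x := combinationᵉ (coordinatesᵉ (inj₂ l)) (inj₂ x)) refl l x n α)

    L′≡linComb : ∀ i j → L′ n α β i j ≡ linComb (coordinates (splitAt p i)) basis j
    L′≡linComb i j = trans (L′≡entry i j) (entry≡combination (splitAt p i) (splitAt p j))

    L′-hasRank4 : HasRank (L′ n α β) 4
    L′-hasRank4 =
        (σ , independent-coordinates (λ i → coordinates (rows i)) basis L′σ≡linComb
                                     coordinates-independent basis-independent)
      , λ τ → dependent-coordinates (λ i → coordinates (splitAt p (τ i))) basis
                                    (λ i → L′≡linComb (τ i)) ℕ.≤-refl
      where
      σ : Fin 4 → Fin (p ℕ.+ p)
      σ i = join p p (rows i)
      L′σ≡linComb : ∀ i j → L′ n α β (σ i) j ≡ linComb (coordinates (rows i)) basis j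
      L′σ≡linComb i j =
        trans (L′≡linComb (σ i) j) (cong (λ R → linComb (coordinates R) basis j) (splitAt-join p p (rows i)))

proposition3p1 : (p : ℕ) .{{_ : NonZero p}} → Prime p → ¬ (2 ∣ p) →
    (n α β : Zmod.Zp p) → Zmod.NonSquare p n →
    Zmod._⊕_ p (Zmod._⊖_ p β (Zmod._⊗_ p n α)) (Zmod._⊕_ p (Zmod._⊗_ p n n) n) ≡ Zmod.𝟘 p →
    Zmod.LogHadamard p (Zmod.L′ p n α β) × Zmod.HasRank p (Zmod.L′ p n α β) 4
proposition3p1 p p-prime odd n α β n-nonsquare β-relation = L′-logHadamard , L′-hasRank4 β-relation
  where open Matrix p p-prime odd n α β n-nonsquare
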